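{- Let $k \in \mathbb{N}$ and let $n, n' > 2k$ be integers. For a partition $\lambda = (\lambda_1,\lambda_2,\ldots,\lambda_r)$ of $n$ with $\lambda_1 \geq n-k$, let $\lambda^* = (\lambda_1 + n' - n, \lambda_2, \ldots, \lambda_r)$, a partition of $n'$. Then $\lambda \mapsto \lambda^*$ is a bijection from $\mathcal{F}_{n,k}$ to $\mathcal{F}_{n',k}$, and for all $\lambda, \mu \in \mathcal{F}_{n,k}$ we have $K_{\lambda,\mu} = K_{\lambda^*,\mu^*}$ and $\xi_{\lambda}(\sigma_\mu) = \xi_{\lambda^*}(\sigma_{\mu^*})$, where $\sigma_\mu \in S_n$ is any permutation of cycle-type $\mu$ and $\sigma_{\mu^*} \in S_{n'}$ is any permutation of cycle-type $\mu^*$. In other words, the minors of the Kostka matrix and of the permutation character table with rows and columns indexed by $\mathcal{F}_{n,k}$ do not depend on $n$ for $n > 2k$.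
   Context: $\mathcal{F}_{n,k} = \{\lambda \vdash n : \lambda_1 \geq n-k\}$. A generalized $\lambda$-tableau is obtained by placing a number from $[n]$ in each cell of the Young diagram of $\lambda$; it has content $\mu$ if it contains $\mu_i$ copies of $i$ for each $i$; it is semistandard if entries are non-decreasing along rows and strictly increasing down columns. The Kostka number $K_{\lambda,\mu}$ is the number of semistandard generalized $\lambda$-tableaux of content $\mu$. A $\lambda$-tabloid is a filling of the Young diagram of $\lambda$ with $1,\ldots,n$ with rows considered as unordered sets; $S_n$ acts on tabloids, and the permutation character $\xi_\lambda(\sigma)$ is the number of $\lambda$-tabloids fixed by $\sigma$ (the character of the permutation module $M^\lambda$). -}

module Defs where

open import Data.Bool using (Bool; true; false; _∧_; if_then_else_)
open import Data.Nat using (ℕ; zero; suc; _+_; _*_; _∸_; _≤_; _<_; _≥_; _≤ᵇ_; _<ᵇ_; _≡ᵇ_)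
open import Data.Fin using (Fin; toℕ)
open import Data.Fin.Permutation using (Permutation′; _⟨$⟩ʳ_)
open import Data.List using (List; []; _∷_; map; concat; concatMap; length; filterᵇ; upTo; allFin; zipWith)
open import Data.Nat.ListAction using (sum)
open import Data.Bool.ListAction using (and; all)
open import Data.List.Relation.Unary.All using (All)
open import Data.List.Relation.Unary.Linked using (Linked)
open import Data.Vec using (Vec; lookup)
import Data.Vec as Vec
open import Data.Product using (_×_)
open import Relation.Binary.PropositionalEquality using (_≡_)
open import Relation.Nullary.Decidable using (⌊_⌋)
import Data.Fin as Fin

IsPartition : ℕ → List ℕ → Set
IsPartition n λ′ = Linked _≥_ λ′ × All (λ a → 0 < a) λ′ × sum λ′ ≡ n

part₁ : List ℕ → ℕ
part₁ []      = 0
part₁ (a ∷ _) = a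

-- i-th part (0-indexed), 0 beyond the length
part : List ℕ → ℕ → ℕ
part []      _       = 0
part (a ∷ _) zero    = a
part (_ ∷ l) (suc i) = part l i

𝓕 : ℕ → ℕ → List ℕ → Set
𝓕 n k λ′ = IsPartition n λ′ × (n ∸ k ≤ part₁ λ′)

-- λ* = (λ₁ + n' - n, λ₂, …); computed as (λ₁ + n') ∸ n, which equals
-- λ₁ + n' - n whenever that integer is ≥ 0 (always so on 𝓕_{n,k}, n' > k).
star : ℕ → ℕ → List ℕ → List ℕ
star n n′ []      = []
star n n′ (a ∷ l) = ((a + n′) ∸ n) ∷ l

eqFin : ∀ {n} → Fin n → Fin n → Bool
eqFin x y = ⌊ x Fin.≟ y ⌋

countFin : ∀ {n} → Fin n → List (Fin n) → ℕ
countFin i xs = length (filterᵇ (eqFin i) xs)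

allLists : (n m : ℕ) → List (List (Fin n))
allLists n zero    = [] ∷ []
allLists n (suc m) = concatMap (λ x → map (x ∷_) (allLists n m)) (allFin n)

allVecs : (r m : ℕ) → List (Vec (Fin r) m)
allVecs r zero    = Vec.[] ∷ []
allVecs r (suc m) = concatMap (λ x → map (x Vec.∷_) (allVecs r m)) (allFin r)

tableaux : (n : ℕ) → List ℕ → List (List (List (Fin n)))
tableaux n []      = [] ∷ []
tableaux n (a ∷ l) = concatMap (λ r → map (r ∷_) (tableaux n l)) (allLists n a)

rowWeak : ∀ {n} → List (Fin n) → Bool
rowWeak []            = true
rowWeak (x ∷ [])      = true
rowWeak (x ∷ y ∷ xs)  = (toℕ x ≤ᵇ toℕ y) ∧ rowWeak (y ∷ xs)

-- strict increase down the columns between a row and the (shorter) next row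
colStrict : ∀ {n} → List (Fin n) → List (Fin n) → Bool
colStrict r₁ r₂ = and (zipWith (λ a b → toℕ a <ᵇ toℕ b) r₁ r₂)

colsStrict : ∀ {n} → List (List (Fin n)) → Bool
colsStrict []             = true
colsStrict (r ∷ [])       = true
colsStrict (r ∷ s ∷ rs)   = colStrict r s ∧ colsStrict (s ∷ rs)

semistandard : ∀ {n} → List (List (Fin n)) → Bool
semistandard T = all rowWeak T ∧ colsStrict T

-- content μ: μ_i copies of i (entries i ∈ [n] indexed from 0 here)
hasContent : ∀ {n} → List ℕ → List (List (Fin n)) → Bool
hasContent {n} μ T = all (λ i → countFin i (concat T) ≡ᵇ part μ (toℕ i)) (allFin n)

kostka : (n : ℕ) → List ℕ → List ℕ → ℕ
kostka n λ′ μ = length (filterᵇ (λ T → semistandard T ∧ hasContent μ T) (tableaux n λ′))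

-- A λ-tabloid is represented by its row-assignment f : [n] → rows,
-- with exactly λ_i elements in row i.
isTabloid : ∀ {n} (λ′ : List ℕ) → Vec (Fin (length λ′)) n → Bool
isTabloid λ′ f = all (λ i → countFin i (Vec.toList f) ≡ᵇ part λ′ (toℕ i)) (allFin (length λ′))

fixedBy : ∀ {n r} → Permutation′ n → Vec (Fin r) n → Bool
fixedBy {n} σ f = all (λ x → eqFin (lookup f (σ ⟨$⟩ʳ x)) (lookup f x)) (allFin n)

ξ : (n : ℕ) → List ℕ → Permutation′ n → ℕ
ξ n λ′ σ = length (filterᵇ (λ f → isTabloid λ′ f ∧ fixedBy σ f) (allVecs (length λ′) n))

iter : ∀ {n} → Permutation′ n → ℕ → Fin n → Fin n
iter σ zero    x = x
iter σ (suc m) x = σ ⟨$⟩ʳ (iter σ m x)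

orbitLen : ∀ {n} → Permutation′ n → Fin n → ℕ
orbitLen {n} σ x = part (filterᵇ (λ m → eqFin (iter σ m x) x) (map suc (upTo n))) 0

-- x is the least element of its cycle (one representative per cycle)
cycleMin : ∀ {n} → Permutation′ n → Fin n → Bool
cycleMin σ x = all (λ j → toℕ x ≤ᵇ toℕ (iter σ j x)) (upTo (orbitLen σ x))

insertDesc : ℕ → List ℕ → List ℕ
insertDesc a []      = a ∷ []
insertDesc a (b ∷ l) = if b ≤ᵇ a then a ∷ b ∷ l else b ∷ insertDesc a l

sortDesc : List ℕ → List ℕ
sortDesc []      = []
sortDesc (a ∷ l) = insertDesc a (sortDesc l)

cycleType : ∀ {n} → Permutation′ n → List ℕ
cycleType {n} σ = sortDesc (map (orbitLen σ) (filterᵇ (cycleMin σ) (allFin n)))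

module Submission where

-- Every λ ∈ 𝓕_{n,k} is (n − |ν|, ν) for a partition ν with |ν| ≤ k, and λ* = (n′ − |ν|, ν); since
-- 2k < n the first part exceeds k, hence exceeds every other part of any member of 𝓕_{n,k}.
-- Kostka numbers: a 1 can only lie in the first row, and as λ₂ ≤ k < μ₁ the 1's cover the whole
-- second row; so adding a cell to the first row and one more 1 (prepended) is a bijection between
-- the tableaux for n and for n + 1.
-- Permutation characters: a tabloid fixed by σ amounts to an assignment of the cycles of σ to the
-- rows that fills each row exactly. The cycle of length μ₁ > k only fits into the first row, and
-- the rest of the count — the cycles μ₂, μ₃, … filling rows of sizes λ₁ − μ₁, λ₂, …, where
-- λ₁ − μ₁ = (μ₂ + μ₃ + ⋯) − (λ₂ + λ₃ + ⋯) — does not involve n.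

open import Defs
open import Data.Bool using (Bool; true; false; _∧_; if_then_else_; T; T?)
open import Data.Bool.ListAction using (all)
open import Data.Empty using (⊥; ⊥-elim)
open import Data.Fin using (Fin; toℕ)
import Data.Fin as Fin
import Data.Fin.Properties as FinP
open import Data.Fin.Permutation using (Permutation′; _⟨$⟩ʳ_; _⟨$⟩ˡ_; inverseˡ)
open import Data.List using (List; []; _∷_; map; concat; concatMap; length; filterᵇ; upTo; allFin; _++_; replicate)
import Data.List
import Data.List.Properties as LP
open import Data.List.Membership.Propositional using (_∈_; find; lose)
open import Data.List.Membership.Propositional.Properties
  using ( ∈-∃++; ∈-++⁺ˡ; ∈-++⁺ʳ; ∈-++⁻; ∈-tabulate⁻; ∈-allFin; ∈-map⁺; ∈-map⁻; ∈-filter⁺; ∈-filter⁻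
        ; ∈-upTo⁺; ∈-upTo⁻; ∈-lookup; ∈-concatMap⁺; ∈-concatMap⁻; ∈-concat⁻′; ∈-concat⁺′)
open import Data.List.Relation.Binary.Permutation.Propositional using (_↭_)
import Data.List.Relation.Binary.Permutation.Propositional as ↭
open import Data.List.Relation.Unary.All using (All; []; _∷_)
import Data.List.Relation.Unary.All as All
open import Data.List.Relation.Unary.Any using (here; there)
import Data.List.Relation.Unary.Any as Any
open import Data.List.Relation.Unary.Any.Properties using (lookup-index)
open import Data.List.Relation.Unary.AllPairs using ([]; _∷_)
open import Data.List.Relation.Unary.Linked using (Linked; []; [-]; _∷_)
open import Data.List.Relation.Unary.Unique.Propositional using (Unique)
import Data.List.Relation.Unary.Unique.Propositional.Properties as Unique
open import Data.Nat using (ℕ; zero; suc; _+_; _*_; _∸_; _≤_; _<_; _≥_; z≤n; s≤s; _≤ᵇ_; _<ᵇ_; _≡ᵇ_)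
open import Data.Nat.DivMod using (_%_; _/_; m≡m%n+[m/n]*n; m%n<n)
open import Data.Nat.ListAction using (sum)
open import Data.Nat.Properties
open import Algebra.Properties.CommutativeSemigroup +-commutativeSemigroup using (interchange)
open import Data.Product using (_×_; Σ; _,_; proj₁; proj₂; ∃)
open import Data.Sum using (_⊎_; inj₁; inj₂)
open import Data.Vec using (Vec; []; _∷_)
import Data.Vec as Vec
import Data.Vec.Properties as VP
open import Relation.Binary.Definitions using (tri<; tri≈; tri>)
open import Relation.Binary.PropositionalEquality
  using (_≡_; refl; sym; trans; cong; cong₂; subst; subst₂; module ≡-Reasoning)
open import Relation.Nullary using (¬_; yes; no)

T⇒≡true : ∀ {b} → T b → b ≡ true
T⇒≡true {true} _ = refl

≡true⇒T : ∀ {b} → b ≡ true → T b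
≡true⇒T refl = _

false≢true : false ≡ true → ⊥
false≢true ()

≡-from-⇔ : ∀ {b c : Bool} → (b ≡ true → c ≡ true) → (c ≡ true → b ≡ true) → b ≡ c
≡-from-⇔ {true}  {true}  f g = refl
≡-from-⇔ {true}  {false} f g = sym (f refl)
≡-from-⇔ {false} {true}  f g = g refl
≡-from-⇔ {false} {false} f g = refl

∧-true : ∀ {a b} → a ≡ true → b ≡ true → a ∧ b ≡ true
∧-true refl refl = refl

∧-trueˡ : ∀ {a b} → a ∧ b ≡ true → a ≡ true
∧-trueˡ {true} e = refl

∧-trueʳ : ∀ {a b} → a ∧ b ≡ true → b ≡ true
∧-trueʳ {true} e = e

≤⇒≤ᵇ≡true : ∀ {m n} → m ≤ n → (m ≤ᵇ n) ≡ true
≤⇒≤ᵇ≡true le = T⇒≡true (≤⇒≤ᵇ le)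

≤ᵇ≡true⇒≤ : ∀ {m n} → (m ≤ᵇ n) ≡ true → m ≤ n
≤ᵇ≡true⇒≤ {m} {n} e = ≤ᵇ⇒≤ m n (≡true⇒T e)

≰⇒≤ᵇ≡false : ∀ {m n} → ¬ (m ≤ n) → (m ≤ᵇ n) ≡ false
≰⇒≤ᵇ≡false {m} {n} m≰n with m ≤ᵇ n in eq
... | false = refl
... | true  = ⊥-elim (m≰n (≤ᵇ≡true⇒≤ eq))

≡⇒≡ᵇ≡true : ∀ {m n} → m ≡ n → (m ≡ᵇ n) ≡ true
≡⇒≡ᵇ≡true {m} {n} e = T⇒≡true (≡⇒≡ᵇ m n e)

≡ᵇ≡true⇒≡ : ∀ {m n} → (m ≡ᵇ n) ≡ true → m ≡ n
≡ᵇ≡true⇒≡ {m} {n} e = ≡ᵇ⇒≡ m n (≡true⇒T e)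

eqFin≡true⇒≡ : ∀ {r} {x y : Fin r} → eqFin x y ≡ true → x ≡ y
eqFin≡true⇒≡ {x = x} {y} e with x Fin.≟ y
... | yes x≡y = x≡y

≡⇒eqFin≡true : ∀ {r} {x y : Fin r} → x ≡ y → eqFin x y ≡ true
≡⇒eqFin≡true {x = x} {y} x≡y with x Fin.≟ y
... | yes _  = refl
... | no x≢y = ⊥-elim (x≢y x≡y)

≢⇒eqFin≡false : ∀ {r} {x y : Fin r} → ¬ x ≡ y → eqFin x y ≡ false
≢⇒eqFin≡false {x = x} {y} x≢y with x Fin.≟ y
... | yes x≡y = ⊥-elim (x≢y x≡y)
... | no _    = refl

eqFin-sym : ∀ {r} (x y : Fin r) → eqFin x y ≡ eqFin y x
eqFin-sym x y = ≡-from-⇔ (λ e → ≡⇒eqFin≡true (sym (eqFin≡true⇒≡ e)))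
                         (λ e → ≡⇒eqFin≡true (sym (eqFin≡true⇒≡ e)))

eqFin-injective : ∀ {r s} {f : Fin r → Fin s} → (∀ {x y} → f x ≡ f y → x ≡ y) →
                  ∀ x y → eqFin (f x) (f y) ≡ eqFin x y
eqFin-injective f-inj x y = ≡-from-⇔ (λ e → ≡⇒eqFin≡true (f-inj (eqFin≡true⇒≡ e)))
                                     (λ e → ≡⇒eqFin≡true (cong _ (eqFin≡true⇒≡ e)))

all-true⁻ : ∀ {A : Set} (p : A → Bool) xs → all p xs ≡ true → ∀ x → x ∈ xs → p x ≡ true
all-true⁻ p (y ∷ xs) e x x∈ with p y in eq
all-true⁻ p (y ∷ xs) e x (here refl)  | true = eq
all-true⁻ p (y ∷ xs) e x (there x∈)   | true = all-true⁻ p xs e x x∈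

all-true⁺ : ∀ {A : Set} (p : A → Bool) xs → (∀ x → x ∈ xs → p x ≡ true) → all p xs ≡ true
all-true⁺ p []       h = refl
all-true⁺ p (y ∷ xs) h rewrite h y (here refl) = all-true⁺ p xs (λ x x∈ → h x (there x∈))

allFin-true⁻ : ∀ {r} (p : Fin r → Bool) → all p (allFin r) ≡ true → ∀ x → p x ≡ true
allFin-true⁻ {r} p e x = all-true⁻ p (allFin r) e x (∈-allFin x)

allFin-true⁺ : ∀ {r} (p : Fin r → Bool) → (∀ x → p x ≡ true) → all p (allFin r) ≡ true
allFin-true⁺ {r} p h = all-true⁺ p (allFin r) (λ x _ → h x)

when : Bool → ℕ → ℕ
when b v = if b then v else 0

when-comm : ∀ b c v → when b (when c v) ≡ when c (when b v)
when-comm true  true  v = refl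
when-comm true  false v = refl
when-comm false true  v = refl
when-comm false false v = refl

when-when : ∀ a b t v → when (a ≤ᵇ t) (when (b ≤ᵇ t ∸ a) v) ≡ when (a + b ≤ᵇ t) v
when-when a b t v with a ≤? t
... | no a≰t
  rewrite ≰⇒≤ᵇ≡false a≰t | ≰⇒≤ᵇ≡false {a + b} {t} (λ le → a≰t (≤-trans (m≤m+n a b) le)) = refl
... | yes a≤t rewrite ≤⇒≤ᵇ≡true a≤t with b ≤? t ∸ a
...   | yes le rewrite ≤⇒≤ᵇ≡true le
                     | ≤⇒≤ᵇ≡true {a + b} {t} (subst (_≤ t) (+-comm b a) (m≤o∸n⇒m+n≤o b a≤t le)) = refl
...   | no nle rewrite ≰⇒≤ᵇ≡false nle
                     | ≰⇒≤ᵇ≡false {a + b} {t} (λ le → nle (m+n≤o⇒m≤o∸n b (subst (_≤ t) (+-comm a b) le))) = refl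

count : ∀ {A : Set} → (A → Bool) → List A → ℕ
count p []       = 0
count p (x ∷ xs) = if p x then suc (count p xs) else count p xs

length-filterᵇ : ∀ {A : Set} (p : A → Bool) xs → length (filterᵇ p xs) ≡ count p xs
length-filterᵇ p []       = refl
length-filterᵇ p (x ∷ xs) with p x
... | true  = cong suc (length-filterᵇ p xs)
... | false = length-filterᵇ p xs

count-++ : ∀ {A : Set} (p : A → Bool) xs ys → count p (xs ++ ys) ≡ count p xs + count p ys
count-++ p []       ys = refl
count-++ p (x ∷ xs) ys with p x
... | true  = cong suc (count-++ p xs ys)
... | false = count-++ p xs ys

count-map : ∀ {A B : Set} (p : B → Bool) (f : A → B) xs → count p (map f xs) ≡ count (λ x → p (f x)) xs
count-map p f []       = refl
count-map p f (x ∷ xs) with p (f x)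
... | true  = cong suc (count-map p f xs)
... | false = count-map p f xs

count-cong : ∀ {A : Set} (p q : A → Bool) xs → (∀ x → x ∈ xs → p x ≡ q x) → count p xs ≡ count q xs
count-cong p q []       h = refl
count-cong p q (x ∷ xs) h with p x | q x | h x (here refl)
... | true  | true  | _ = cong suc (count-cong p q xs (λ y y∈ → h y (there y∈)))
... | false | false | _ = count-cong p q xs (λ y y∈ → h y (there y∈))

count≡0 : ∀ {A : Set} (p : A → Bool) xs → (∀ x → x ∈ xs → p x ≡ false) → count p xs ≡ 0
count≡0 p []       h = refl
count≡0 p (x ∷ xs) h with p x | h x (here refl)
... | false | _ = count≡0 p xs (λ y y∈ → h y (there y∈))

count≡0⇒false : ∀ {A : Set} (p : A → Bool) xs → count p xs ≡ 0 → ∀ y → y ∈ xs → p y ≡ false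
count≡0⇒false p (x ∷ xs) e y y∈ with p x in eq
count≡0⇒false p (x ∷ xs) () y y∈          | true
count≡0⇒false p (x ∷ xs) e y (here refl)  | false = eq
count≡0⇒false p (x ∷ xs) e y (there y∈)   | false = count≡0⇒false p xs e y y∈

count-const : ∀ {A : Set} b (xs : List A) → count (λ _ → b) xs ≡ when b (length xs)
count-const true  []       = refl
count-const false []       = refl
count-const true  (x ∷ xs) = cong suc (count-const true xs)
count-const false (x ∷ xs) = count-const false xs

count-∧ : ∀ {A : Set} b (q : A → Bool) xs → count (λ a → b ∧ q a) xs ≡ when b (count q xs)
count-∧ true  q xs = refl
count-∧ false q xs = count≡0 _ xs (λ _ _ → refl)

sumBy : ∀ {A : Set} → (A → ℕ) → List A → ℕ
sumBy f []       = 0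
sumBy f (x ∷ xs) = f x + sumBy f xs

sumBy-cong : ∀ {A : Set} (f g : A → ℕ) xs → (∀ x → x ∈ xs → f x ≡ g x) → sumBy f xs ≡ sumBy g xs
sumBy-cong f g []       h = refl
sumBy-cong f g (x ∷ xs) h = cong₂ _+_ (h x (here refl)) (sumBy-cong f g xs (λ y y∈ → h y (there y∈)))

sumBy≡0 : ∀ {A : Set} (f : A → ℕ) xs → (∀ x → x ∈ xs → f x ≡ 0) → sumBy f xs ≡ 0
sumBy≡0 f []       h = refl
sumBy≡0 f (x ∷ xs) h rewrite h x (here refl) = sumBy≡0 f xs (λ y y∈ → h y (there y∈))

sumBy-+ : ∀ {A : Set} (f g : A → ℕ) xs → sumBy (λ x → f x + g x) xs ≡ sumBy f xs + sumBy g xs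
sumBy-+ f g []       = refl
sumBy-+ f g (x ∷ xs) rewrite sumBy-+ f g xs = interchange (f x) (g x) (sumBy f xs) (sumBy g xs)

sumBy-swap : ∀ {A B : Set} (F : A → B → ℕ) xs ys →
  sumBy (λ x → sumBy (F x) ys) xs ≡ sumBy (λ y → sumBy (λ x → F x y) xs) ys
sumBy-swap F []       ys = sym (sumBy≡0 _ ys (λ _ _ → refl))
sumBy-swap F (x ∷ xs) ys =
  trans (cong (sumBy (F x) ys +_) (sumBy-swap F xs ys)) (sym (sumBy-+ (F x) _ ys))

when-sumBy : ∀ {A : Set} b (f : A → ℕ) xs → when b (sumBy f xs) ≡ sumBy (λ x → when b (f x)) xs
when-sumBy true  f xs = refl
when-sumBy false f xs = sym (sumBy≡0 _ xs (λ _ _ → refl))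

sumBy-map : ∀ {A B : Set} (h : B → ℕ) (g : A → B) xs → sumBy h (map g xs) ≡ sumBy (λ x → h (g x)) xs
sumBy-map h g []       = refl
sumBy-map h g (x ∷ xs) = cong (h (g x) +_) (sumBy-map h g xs)

sumBy-tabulate : ∀ {A : Set} {m} (h : A → ℕ) (g : Fin m → A) →
  sumBy h (Data.List.tabulate g) ≡ sumBy (λ j → h (g j)) (allFin m)
sumBy-tabulate h g = trans (cong (sumBy h) (sym (LP.map-tabulate (λ j → j) g))) (sumBy-map h g (allFin _))

sumBy-lookup : ∀ {A : Set} (h : A → ℕ) (xs : List A) →
  sumBy h xs ≡ sumBy (λ j → h (Data.List.lookup xs j)) (allFin (length xs))
sumBy-lookup h xs = trans (cong (sumBy h) (sym (LP.tabulate-lookup xs))) (sumBy-tabulate h (Data.List.lookup xs))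

count-concatMap : ∀ {A B : Set} (p : B → Bool) (f : A → List B) xs →
  count p (concatMap f xs) ≡ sumBy (λ x → count p (f x)) xs
count-concatMap p f []       = refl
count-concatMap p f (x ∷ xs) =
  trans (count-++ p (f x) (concatMap f xs)) (cong (count p (f x) +_) (count-concatMap p f xs))

Embeds : ∀ {A B : Set} → (A → Bool) → List A → (B → Bool) → List B → (A → B) → (B → A) → Set
Embeds p xs q ys f g = ∀ a → a ∈ xs → p a ≡ true → (f a ∈ ys × q (f a) ≡ true) × g (f a) ≡ a

∈-filterᵇ⁻ : ∀ {A : Set} (p : A → Bool) {xs y} → y ∈ filterᵇ p xs → y ∈ xs × p y ≡ true
∈-filterᵇ⁻ p {xs} y∈ = let y∈xs , py = ∈-filter⁻ (λ x → T? (p x)) {xs = xs} y∈ in y∈xs , T⇒≡true py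

∈-filterᵇ⁺ : ∀ {A : Set} (p : A → Bool) {xs y} → y ∈ xs → p y ≡ true → y ∈ filterᵇ p xs
∈-filterᵇ⁺ p y∈ py = ∈-filter⁺ (λ x → T? (p x)) y∈ (≡true⇒T py)

filterᵇ-unique : ∀ {A : Set} (p : A → Bool) {xs} → Unique xs → Unique (filterᵇ p xs)
filterᵇ-unique p = Unique.filter⁺ (λ x → T? (p x))

length-≤-by-injection : ∀ {A B : Set} (f : A → B) (us : List A) (vs : List B) → Unique us →
  (∀ x → x ∈ us → f x ∈ vs) → (∀ x y → x ∈ us → y ∈ us → f x ≡ f y → x ≡ y) →
  length us ≤ length vs
length-≤-by-injection f []       vs u into inj = z≤n
length-≤-by-injection f (x ∷ us) vs (x∉us ∷ u) into inj with ∈-∃++ (into x (here refl))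
... | ys , zs , refl = begin
  suc (length us)          ≤⟨ s≤s (length-≤-by-injection f us (ys ++ zs) u into′ inj′) ⟩
  suc (length (ys ++ zs))  ≡⟨ cong suc (LP.length-++ ys) ⟩
  suc (length ys + length zs) ≡⟨ sym (+-suc (length ys) (length zs)) ⟩
  length ys + suc (length zs) ≡⟨ sym (LP.length-++ ys) ⟩
  length (ys ++ f x ∷ zs)  ∎
  where
  open ≤-Reasoning
  inj′ : ∀ a b → a ∈ us → b ∈ us → f a ≡ f b → a ≡ b
  inj′ a b a∈ b∈ = inj a b (there a∈) (there b∈)
  into′ : ∀ y → y ∈ us → f y ∈ ys ++ zs
  into′ y y∈ with ∈-++⁻ ys (into y (there y∈))
  ... | inj₁ fy∈ys           = ∈-++⁺ˡ fy∈ys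
  ... | inj₂ (there fy∈zs)   = ∈-++⁺ʳ ys fy∈zs
  ... | inj₂ (here fy≡fx)    = ⊥-elim (All.lookup x∉us y∈ (sym (inj y x (there y∈) (here refl) fy≡fx)))

count-≤ : ∀ {A B : Set} (p : A → Bool) (q : B → Bool) (f : A → B) (g : B → A) xs ys →
  Unique xs → Embeds p xs q ys f g → count p xs ≤ count q ys
count-≤ p q f g xs ys u emb =
  subst₂ _≤_ (length-filterᵇ p xs) (length-filterᵇ q ys)
    (length-≤-by-injection f (filterᵇ p xs) (filterᵇ q ys) (filterᵇ-unique p u) into inj)
  where
  into : ∀ a → a ∈ filterᵇ p xs → f a ∈ filterᵇ q ys
  into a a∈ = let a∈xs , pa = ∈-filterᵇ⁻ p a∈ ; (fa∈ys , qfa) , _ = emb a a∈xs pa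
              in ∈-filterᵇ⁺ q fa∈ys qfa
  inj : ∀ a b → a ∈ filterᵇ p xs → b ∈ filterᵇ p xs → f a ≡ f b → a ≡ b
  inj a b a∈ b∈ fa≡fb =
    let a∈xs , pa = ∈-filterᵇ⁻ p a∈ ; b∈xs , pb = ∈-filterᵇ⁻ p b∈
    in trans (sym (proj₂ (emb a a∈xs pa))) (trans (cong g fa≡fb) (proj₂ (emb b b∈xs pb)))

count-≡ : ∀ {A B : Set} (p : A → Bool) (q : B → Bool) (f : A → B) (g : B → A) xs ys →
  Unique xs → Unique ys → Embeds p xs q ys f g → Embeds q ys p xs g f → count p xs ≡ count q ys
count-≡ p q f g xs ys ux uy f-emb g-emb =
  ≤-antisym (count-≤ p q f g xs ys ux f-emb) (count-≤ q p g f ys xs uy g-emb)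

∈-concatMap⁺′ : ∀ {A B : Set} (h : A → List B) {xs x v} → x ∈ xs → v ∈ h x → v ∈ concatMap h xs
∈-concatMap⁺′ h x∈ v∈ = ∈-concatMap⁺ h (lose x∈ v∈)

∈-concatMap⁻′ : ∀ {A B : Set} (h : A → List B) xs {v} → v ∈ concatMap h xs → ∃ λ x → x ∈ xs × v ∈ h x
∈-concatMap⁻′ h xs v∈ = find (∈-concatMap⁻ h {xs = xs} v∈)

concatMap-unique : ∀ {A B : Set} (h : A → List B) xs → Unique xs → (∀ x → x ∈ xs → Unique (h x)) →
  (∀ x y v → x ∈ xs → y ∈ xs → v ∈ h x → v ∈ h y → x ≡ y) → Unique (concatMap h xs)
concatMap-unique h []       u uh disj = []
concatMap-unique h (x ∷ xs) (x∉xs ∷ u) uh disj =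
  Unique.++⁺ (uh x (here refl))
    (concatMap-unique h xs u (λ y y∈ → uh y (there y∈)) (λ a b v a∈ b∈ → disj a b v (there a∈) (there b∈)))
    (λ {v} (v∈hx , v∈rest) → let y , y∈ , v∈hy = ∈-concatMap⁻′ h xs v∈rest
                             in All.lookup x∉xs y∈ (disj x y v (here refl) (there y∈) v∈hx v∈hy))

map-unique-on : ∀ {A B : Set} (f : A → B) xs → Unique xs →
  (∀ x y → x ∈ xs → y ∈ xs → f x ≡ f y → x ≡ y) → Unique (map f xs)
map-unique-on f []       u inj = []
map-unique-on f (x ∷ xs) (x∉xs ∷ u) inj =
  All.tabulate (λ v∈ fx≡v → let y , y∈ , v≡fy = ∈-map⁻ f v∈
                            in All.lookup x∉xs y∈ (inj x y (here refl) (there y∈) (trans fx≡v v≡fy)))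
  ∷ map-unique-on f xs u (λ a b a∈ b∈ → inj a b (there a∈) (there b∈))

prepend-unique : ∀ {A C : Set} {r} (_∷′_ : Fin r → C → A) →
  (∀ {x y u v} → x ∷′ u ≡ y ∷′ v → x ≡ y × u ≡ v) →
  ∀ {cs} → Unique cs → Unique (concatMap (λ x → map (x ∷′_) cs) (allFin r))
prepend-unique {r = r} _∷′_ ∷′-inj uc =
  concatMap-unique _ (allFin r) (Unique.allFin⁺ r)
    (λ x _ → Unique.map⁺ (λ e → proj₂ (∷′-inj e)) uc)
    (λ x y v _ _ v∈x v∈y → let _ , _ , e₁ = ∈-map⁻ _ v∈x ; _ , _ , e₂ = ∈-map⁻ _ v∈y
                           in proj₁ (∷′-inj (trans (sym e₁) e₂)))

allVecs-complete : ∀ r m (v : Vec (Fin r) m) → v ∈ allVecs r m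
allVecs-complete r zero    []      = here refl
allVecs-complete r (suc m) (x ∷ v) =
  ∈-concatMap⁺′ _ (∈-allFin x) (∈-map⁺ (x Vec.∷_) (allVecs-complete r m v))

allVecs-unique : ∀ r m → Unique (allVecs r m)
allVecs-unique r zero    = [] ∷ []
allVecs-unique r (suc m) = prepend-unique Vec._∷_ VP.∷-injective (allVecs-unique r m)

allLists-complete : ∀ N (row : List (Fin N)) → row ∈ allLists N (length row)
allLists-complete N []        = here refl
allLists-complete N (x ∷ row) = ∈-concatMap⁺′ _ (∈-allFin x) (∈-map⁺ (x ∷_) (allLists-complete N row))

allLists-sound : ∀ N m {row : List (Fin N)} → row ∈ allLists N m → length row ≡ m
allLists-sound N zero    (here refl) = refl
allLists-sound N (suc m) row∈ with ∈-concatMap⁻′ _ (allFin N) row∈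
... | x , _ , row∈′ with ∈-map⁻ (x ∷_) row∈′
... | row′ , row′∈ , refl = cong suc (allLists-sound N m row′∈)

allLists-unique : ∀ N m → Unique (allLists N m)
allLists-unique N zero    = [] ∷ []
allLists-unique N (suc m) = prepend-unique _∷_ LP.∷-injective (allLists-unique N m)

tableaux-complete : ∀ N (T : List (List (Fin N))) → T ∈ tableaux N (map length T)
tableaux-complete N []      = here refl
tableaux-complete N (r ∷ T) =
  ∈-concatMap⁺′ _ (allLists-complete N r) (∈-map⁺ (r ∷_) (tableaux-complete N T))

tableaux-sound : ∀ N shape {T : List (List (Fin N))} → T ∈ tableaux N shape → map length T ≡ shape
tableaux-sound N []          (here refl) = refl
tableaux-sound N (a ∷ shape) T∈ with ∈-concatMap⁻′ _ (allLists N a) T∈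
... | r , r∈ , T∈′ with ∈-map⁻ (r ∷_) T∈′
... | T′ , T′∈ , refl = cong₂ _∷_ (allLists-sound N a r∈) (tableaux-sound N shape T′∈)

tableaux-unique : ∀ N shape → Unique (tableaux N shape)
tableaux-unique N []          = [] ∷ []
tableaux-unique N (a ∷ shape) =
  concatMap-unique _ (allLists N a) (allLists-unique N a)
    (λ x _ → Unique.map⁺ LP.∷-injectiveʳ (tableaux-unique N shape))
    (λ x y v _ _ v∈x v∈y → let _ , _ , e₁ = ∈-map⁻ _ v∈x ; _ , _ , e₂ = ∈-map⁻ _ v∈y
                           in LP.∷-injectiveˡ (trans (sym e₁) e₂))

lookup-injective : ∀ {A : Set} (xs : List A) → Unique xs → ∀ i j →
  Data.List.lookup xs i ≡ Data.List.lookup xs j → i ≡ j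
lookup-injective (x ∷ xs) u          Fin.zero    Fin.zero    e = refl
lookup-injective (x ∷ xs) (x∉ ∷ u)   Fin.zero    (Fin.suc j) e = ⊥-elim (All.lookup x∉ (∈-lookup j) e)
lookup-injective (x ∷ xs) (x∉ ∷ u)   (Fin.suc i) Fin.zero    e = ⊥-elim (All.lookup x∉ (∈-lookup i) (sym e))
lookup-injective (x ∷ xs) (x∉ ∷ u)   (Fin.suc i) (Fin.suc j) e = cong Fin.suc (lookup-injective xs u i j e)

range : ℕ → ℕ → List ℕ
range a zero    = []
range a (suc m) = a ∷ range (suc a) m

map-suc-upTo : ∀ m → map suc (upTo m) ≡ range 1 m
map-suc-upTo m = trans (LP.map-applyUpTo (λ i → i) suc m) (applyUpTo-range suc 1 m (λ i → refl))
  where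
  applyUpTo-range : ∀ (f : ℕ → ℕ) a m → (∀ i → f i ≡ a + i) → Data.List.applyUpTo f m ≡ range a m
  applyUpTo-range f a zero    h = refl
  applyUpTo-range f a (suc m) h =
    cong₂ _∷_ (trans (h 0) (+-identityʳ a)) (applyUpTo-range (λ i → f (suc i)) (suc a) m (λ i → trans (h (suc i)) (+-suc a i)))

record LeastFrom (P : ℕ → Bool) (a v : ℕ) : Set where
  field
    lower : a ≤ v
    hit   : P v ≡ true
    least : ∀ j → a ≤ j → j < v → P j ≡ false

head-filterᵇ-range : ∀ (P : ℕ → Bool) a m j → a ≤ j → j < a + m → P j ≡ true →
  LeastFrom P a (part (filterᵇ P (range a m)) 0)
head-filterᵇ-range P a zero    j a≤j j<a+m Pj = ⊥-elim (<⇒≱ j<a+m (subst (_≤ j) (sym (+-identityʳ a)) a≤j))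
head-filterᵇ-range P a (suc m) j a≤j j<a+m Pj with P a in Pa
... | true  = record { lower = ≤-refl ; hit = Pa ; least = λ j′ a≤j′ j′<a → ⊥-elim (<⇒≱ j′<a a≤j′) }
... | false = record { lower = ≤-trans (n≤1+n a) lower ; hit = hit ; least = least′ }
  where
  a≢j : ¬ a ≡ j
  a≢j refl = false≢true (trans (sym Pa) Pj)
  open LeastFrom (head-filterᵇ-range P (suc a) m j (≤∧≢⇒< a≤j a≢j) (subst (j <_) (+-suc a m) j<a+m) Pj)
  least′ : ∀ j′ → a ≤ j′ → j′ < part (filterᵇ P (range (suc a) m)) 0 → P j′ ≡ false
  least′ j′ a≤j′ j′<v with a ≟ j′
  ... | yes refl = Pa
  ... | no a≢j′  = least j′ (≤∧≢⇒< a≤j′ a≢j′) j′<v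

argmin : (ℕ → ℕ) → ℕ → ℕ
argmin g zero    = 0
argmin g (suc B) = if g B <ᵇ g (argmin g B) then B else argmin g B

argmin-spec : ∀ g B → argmin g (suc B) < suc B × (∀ j → j < suc B → g (argmin g (suc B)) ≤ g j)
argmin-spec g zero with g 0 <ᵇ g 0
... | true  = s≤s z≤n , λ { .0 (s≤s z≤n) → ≤-refl }
... | false = s≤s z≤n , λ { .0 (s≤s z≤n) → ≤-refl }
argmin-spec g (suc B) with argmin-spec g B | g (suc B) <ᵇ g (argmin g (suc B)) in eq
... | (_ , minimal) | true = ≤-refl , below
  where
  new< : g (suc B) < g (argmin g (suc B))
  new< = <ᵇ⇒< (g (suc B)) (g (argmin g (suc B))) (≡true⇒T eq)
  below : ∀ j → j < suc (suc B) → g (suc B) ≤ g j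
  below j (s≤s j≤) with j ≟ suc B
  ... | yes refl = ≤-refl
  ... | no j≢    = ≤-trans (<⇒≤ new<) (minimal j (≤∧≢⇒< j≤ j≢))
... | (old< , minimal) | false = ≤-trans old< (n≤1+n _) , below
  where
  new≮ : ¬ g (suc B) < g (argmin g (suc B))
  new≮ lt = subst T eq (<⇒<ᵇ lt)
  below : ∀ j → j < suc (suc B) → g (argmin g (suc B)) ≤ g j
  below j (s≤s j≤) with j ≟ suc B
  ... | yes refl = ≮⇒≥ new≮
  ... | no j≢    = minimal j (≤∧≢⇒< j≤ j≢)

record SmallPartition (k : ℕ) (ν : List ℕ) : Set where
  field
    decreasing : Linked _≥_ ν
    positive   : All (λ a → 0 < a) ν
    small      : sum ν ≤ k

withHead : ℕ → List ℕ → List ℕ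
withHead n ν = (n ∸ sum ν) ∷ ν

k<n : ∀ {k n} → 2 * k < n → k < n
k<n {k} 2k<n = ≤-<-trans (m≤m+n k (k + 0)) 2k<n

k<n∸k : ∀ {k n} → 2 * k < n → k < n ∸ k
k<n∸k {k} {n} 2k<n = +-cancelʳ-< k k (n ∸ k) (begin-strict
  k + k       ≡⟨ cong (k +_) (sym (+-identityʳ k)) ⟩
  2 * k       <⟨ 2k<n ⟩
  n           ≡⟨ sym (m∸n+n≡m (<⇒≤ (k<n {k} 2k<n))) ⟩
  n ∸ k + k   ∎)
  where open ≤-Reasoning

k<withHead : ∀ {k n} ν → 2 * k < n → sum ν ≤ k → k < n ∸ sum ν
k<withHead ν 2k<n ν≤k = <-≤-trans (k<n∸k 2k<n) (∸-monoʳ-≤ _ ν≤k)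

head≤sum : ∀ ν → part₁ ν ≤ sum ν
head≤sum []      = z≤n
head≤sum (a ∷ ν) = m≤m+n a (sum ν)

withHead-decreasing : ∀ {k n} ν → 2 * k < n → SmallPartition k ν → Linked _≥_ (withHead n ν)
withHead-decreasing []      2k<n small = [-]
withHead-decreasing (a ∷ ν) 2k<n small =
  ≤-trans (≤-trans (head≤sum (a ∷ ν)) ν≤k) (<⇒≤ (k<withHead (a ∷ ν) 2k<n ν≤k)) ∷ decreasing
  where open SmallPartition small renaming (small to ν≤k)

withHead-𝓕 : ∀ {k n} ν → 2 * k < n → SmallPartition k ν → 𝓕 n k (withHead n ν)
withHead-𝓕 {k} {n} ν 2k<n small =
  (withHead-decreasing ν 2k<n small , head>0 ∷ positive , m∸n+n≡m sum≤n) , ∸-monoʳ-≤ n ν≤k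
  where
  open SmallPartition small renaming (small to ν≤k)
  head>0 : 0 < n ∸ sum ν
  head>0 = ≤-<-trans z≤n (k<withHead ν 2k<n ν≤k)
  sum≤n : sum ν ≤ n
  sum≤n = ≤-trans ν≤k (<⇒≤ (k<n {k} 2k<n))

𝓕-withHead : ∀ {k n} λ′ → k < n → 𝓕 n k λ′ → ∃ λ ν → SmallPartition k ν × λ′ ≡ withHead n ν
𝓕-withHead []      k<n ((_ , _ , sum≡n) , _) = ⊥-elim (<⇒≢ (≤-<-trans z≤n k<n) sum≡n)
𝓕-withHead {k} {n} (a ∷ ν) k<n ((dec , _ ∷ pos , a+ν≡n) , n∸k≤a) =
  ν , record { decreasing = tail dec ; positive = pos ; small = ν≤k } , cong (_∷ ν) a≡
  where
  tail : ∀ {x xs} → Linked _≥_ (x ∷ xs) → Linked _≥_ xs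
  tail [-]       = []
  tail (_ ∷ lk)  = lk
  a≡ : a ≡ n ∸ sum ν
  a≡ = sym (trans (cong (_∸ sum ν) (sym a+ν≡n)) (m+n∸n≡m a (sum ν)))
  ν≤k : sum ν ≤ k
  ν≤k = +-cancelˡ-≤ (n ∸ k) (sum ν) k (begin
    n ∸ k + sum ν  ≤⟨ +-monoˡ-≤ (sum ν) n∸k≤a ⟩
    a + sum ν      ≡⟨ a+ν≡n ⟩
    n              ≡⟨ sym (m∸n+n≡m (<⇒≤ k<n)) ⟩
    n ∸ k + k      ∎)
    where open ≤-Reasoning

star-withHead : ∀ n n′ ν → sum ν ≤ n → sum ν ≤ n′ → star n n′ (withHead n ν) ≡ withHead n′ ν
star-withHead n n′ ν t≤n t≤n′ = cong (_∷ ν) (begin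
  (n ∸ t) + n′ ∸ n              ≡⟨ cong (λ z → (n ∸ t) + z ∸ n) (sym (m+[n∸m]≡n t≤n′)) ⟩
  (n ∸ t) + (t + (n′ ∸ t)) ∸ n  ≡⟨ cong (_∸ n) (sym (+-assoc (n ∸ t) t (n′ ∸ t))) ⟩
  (n ∸ t) + t + (n′ ∸ t) ∸ n    ≡⟨ cong (λ z → z + (n′ ∸ t) ∸ n) (m∸n+n≡m t≤n) ⟩
  n + (n′ ∸ t) ∸ n              ≡⟨ m+n∸m≡n n (n′ ∸ t) ⟩
  n′ ∸ t                        ∎)
  where
  open ≡-Reasoning
  t : ℕ
  t = sum ν

module _ {k n n′ : ℕ} (2k<n : 2 * k < n) (2k<n′ : 2 * k < n′) where

  star-withHead-small : ∀ {ν} → SmallPartition k ν → star n n′ (withHead n ν) ≡ withHead n′ ν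
  star-withHead-small {ν} small = star-withHead n n′ ν (≤-trans ν≤k (<⇒≤ (k<n {k} 2k<n)))
                                                       (≤-trans ν≤k (<⇒≤ (k<n {k} 2k<n′)))
    where open SmallPartition small renaming (small to ν≤k)

  star-𝓕 : (λ′ : List ℕ) → 𝓕 n k λ′ → 𝓕 n′ k (star n n′ λ′)
  star-𝓕 λ′ λ′∈𝓕 with 𝓕-withHead λ′ (k<n {k} 2k<n) λ′∈𝓕
  ... | ν , small , refl = subst (𝓕 n′ k) (sym (star-withHead-small small)) (withHead-𝓕 {k} ν 2k<n′ small)

  star-injective : (λ′ ν : List ℕ) → 𝓕 n k λ′ → 𝓕 n k ν → star n n′ λ′ ≡ star n n′ ν → λ′ ≡ ν
  star-injective λ′ ν λ′∈𝓕 ν∈𝓕 e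
    with 𝓕-withHead λ′ (k<n {k} 2k<n) λ′∈𝓕 | 𝓕-withHead ν (k<n {k} 2k<n) ν∈𝓕
  ... | α , α-small , refl | β , β-small , refl =
    cong (withHead n) (LP.∷-injectiveʳ (begin
      withHead n′ α              ≡⟨ sym (star-withHead-small α-small) ⟩
      star n n′ (withHead n α)   ≡⟨ e ⟩
      star n n′ (withHead n β)   ≡⟨ star-withHead-small β-small ⟩
      withHead n′ β              ∎))
    where open ≡-Reasoning

  star-surjective : (ν : List ℕ) → 𝓕 n′ k ν → Σ (List ℕ) (λ λ′ → 𝓕 n k λ′ × star n n′ λ′ ≡ ν)
  star-surjective ν ν∈𝓕 with 𝓕-withHead ν (k<n {k} 2k<n′) ν∈𝓕
  ... | α , small , refl = withHead n α , withHead-𝓕 {k} α 2k<n small , star-withHead-small small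

NoZero : ∀ {N} → List (Fin N) → Set
NoZero row = ∀ y → y ∈ row → 0 < toℕ y

rowWeak-∷⁻ : ∀ {N} (x : Fin N) r → rowWeak (x ∷ r) ≡ true → rowWeak r ≡ true
rowWeak-∷⁻ x []      e = refl
rowWeak-∷⁻ x (y ∷ r) e = ∧-trueʳ {toℕ x ≤ᵇ toℕ y} e

rowWeak-head-≤ : ∀ {N} (x : Fin N) r → rowWeak (x ∷ r) ≡ true → ∀ y → y ∈ r → toℕ x ≤ toℕ y
rowWeak-head-≤ x (y ∷ r) e .y (here refl) = ≤ᵇ≡true⇒≤ (∧-trueˡ e)
rowWeak-head-≤ x (y ∷ r) e z  (there z∈)  =
  ≤-trans (≤ᵇ≡true⇒≤ (∧-trueˡ e)) (rowWeak-head-≤ y r (∧-trueʳ {toℕ x ≤ᵇ toℕ y} e) z z∈)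

rowWeak-zeros-prefix : ∀ {N} (r : List (Fin (suc N))) → rowWeak r ≡ true →
  ∃ λ r′ → r ≡ replicate (count (eqFin Fin.zero) r) Fin.zero ++ r′
rowWeak-zeros-prefix []               e = [] , refl
rowWeak-zeros-prefix (Fin.zero  ∷ r)  e =
  let r′ , r≡ = rowWeak-zeros-prefix r (rowWeak-∷⁻ Fin.zero r e) in r′ , cong (Fin.zero ∷_) r≡
rowWeak-zeros-prefix (Fin.suc y ∷ r)  e =
  Fin.suc y ∷ r , cong (λ m → replicate m Fin.zero ++ Fin.suc y ∷ r) (sym no-zeros)
  where
  nonzero : ∀ x → suc (toℕ y) ≤ toℕ x → eqFin Fin.zero x ≡ false
  nonzero (Fin.suc x) _ = refl
  no-zeros : count (eqFin Fin.zero) r ≡ 0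
  no-zeros = count≡0 _ r (λ x x∈ → nonzero x (rowWeak-head-≤ (Fin.suc y) r e x x∈))

colStrict-below-NoZero : ∀ {N} (r s : List (Fin N)) → colStrict r s ≡ true → length s ≤ length r → NoZero s
colStrict-below-NoZero (x ∷ r) (y ∷ s) e (s≤s le) .y (here refl) = ≤-<-trans z≤n (<ᵇ⇒< (toℕ x) (toℕ y) (≡true⇒T (∧-trueˡ e)))
colStrict-below-NoZero (x ∷ r) (y ∷ s) e (s≤s le) z  (there z∈)  = colStrict-below-NoZero r s (∧-trueʳ {toℕ x <ᵇ toℕ y} e) le z z∈

colStrict-under-zeros : ∀ {N} p (r′ s : List (Fin (suc N))) → length s ≤ p → NoZero s →
  colStrict (replicate p Fin.zero ++ r′) s ≡ true
colStrict-under-zeros zero    []       []      le h = refl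
colStrict-under-zeros zero    (x ∷ r′) []      le h = refl
colStrict-under-zeros (suc p) r′       []      le h = refl
colStrict-under-zeros (suc p) r′       (y ∷ s) (s≤s le) h =
  ∧-true (T⇒≡true (<⇒<ᵇ (h y (here refl)))) (colStrict-under-zeros p r′ s le (λ z z∈ → h z (there z∈)))

colsStrict-lower-NoZero : ∀ {N} (r : List (Fin N)) rs → colsStrict (r ∷ rs) ≡ true → Linked _≥_ (map length (r ∷ rs)) →
  ∀ row → row ∈ rs → NoZero row
colsStrict-lower-NoZero r (s ∷ rs) e (le ∷ lk) .s  (here refl)   = colStrict-below-NoZero r s (∧-trueˡ e) le
colsStrict-lower-NoZero r (s ∷ rs) e (le ∷ lk) row (there row∈)  =
  colsStrict-lower-NoZero s rs (∧-trueʳ {colStrict r s} e) lk row row∈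

count-zero-concat : ∀ {N} (rs : List (List (Fin (suc N)))) → (∀ row → row ∈ rs → NoZero row) →
  count (eqFin Fin.zero) (concat rs) ≡ 0
count-zero-concat rs h = count≡0 _ (concat rs) (λ x x∈ → nonzero x (positive x x∈))
  where
  positive : ∀ x → x ∈ concat rs → 0 < toℕ x
  positive x x∈ = let row , x∈row , row∈ = ∈-concat⁻′ rs x∈ in h row row∈ x x∈row
  nonzero : ∀ x → 0 < toℕ x → eqFin Fin.zero x ≡ false
  nonzero (Fin.suc x) _ = refl

count-++-right≡0 : ∀ {A : Set} (p : A → Bool) xs ys {m} → count p (xs ++ ys) ≡ m → count p ys ≡ 0 → count p xs ≡ m
count-++-right≡0 p xs ys e zs≡0 = begin
  count p xs                  ≡⟨ sym (+-identityʳ _) ⟩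
  count p xs + 0              ≡⟨ cong (count p xs +_) (sym zs≡0) ⟩
  count p xs + count p ys     ≡⟨ sym (count-++ p xs ys) ⟩
  count p (xs ++ ys)          ≡⟨ e ⟩
  _                           ∎
  where open ≡-Reasoning

Content : ∀ {N} → List ℕ → List (List (Fin N)) → Set
Content {N} μ T = ∀ (i : Fin N) → count (eqFin i) (concat T) ≡ part μ (toℕ i)

hasContent⇒Content : ∀ {N} μ (T : List (List (Fin N))) → hasContent μ T ≡ true → Content μ T
hasContent⇒Content μ T e i = trans (sym (length-filterᵇ (eqFin i) (concat T))) (≡ᵇ≡true⇒≡ (allFin-true⁻ _ e i))

Content⇒hasContent : ∀ {N} μ (T : List (List (Fin N))) → Content μ T → hasContent μ T ≡ true
Content⇒hasContent μ T h = allFin-true⁺ _ (λ i → ≡⇒≡ᵇ≡true (trans (length-filterᵇ (eqFin i) (concat T)) (h i)))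

ι : ∀ {N} → Fin N → Fin (suc N)
ι = Fin.inject₁

rowWeak-ι : ∀ {N} (r : List (Fin N)) → rowWeak (map ι r) ≡ rowWeak r
rowWeak-ι []          = refl
rowWeak-ι (x ∷ [])    = refl
rowWeak-ι (x ∷ y ∷ r) = cong₂ _∧_ (cong₂ _≤ᵇ_ (FinP.toℕ-inject₁ x) (FinP.toℕ-inject₁ y)) (rowWeak-ι (y ∷ r))

colStrict-ι : ∀ {N} (r s : List (Fin N)) → colStrict (map ι r) (map ι s) ≡ colStrict r s
colStrict-ι []      []      = refl
colStrict-ι []      (y ∷ s) = refl
colStrict-ι (x ∷ r) []      = refl
colStrict-ι (x ∷ r) (y ∷ s) = cong₂ _∧_ (cong₂ _<ᵇ_ (FinP.toℕ-inject₁ x) (FinP.toℕ-inject₁ y)) (colStrict-ι r s)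

colsStrict-ι : ∀ {N} (rs : List (List (Fin N))) → colsStrict (map (map ι) rs) ≡ colsStrict rs
colsStrict-ι []           = refl
colsStrict-ι (r ∷ [])     = refl
colsStrict-ι (r ∷ s ∷ rs) = cong₂ _∧_ (colStrict-ι r s) (colsStrict-ι (s ∷ rs))

all-rowWeak-ι : ∀ {N} (rs : List (List (Fin N))) → all rowWeak (map (map ι) rs) ≡ all rowWeak rs
all-rowWeak-ι []       = refl
all-rowWeak-ι (r ∷ rs) = cong₂ _∧_ (rowWeak-ι r) (all-rowWeak-ι rs)

count-ι : ∀ {N} (i : Fin N) xs → count (eqFin (ι i)) (map ι xs) ≡ count (eqFin i) xs
count-ι i xs = trans (count-map (eqFin (ι i)) ι xs)
                     (count-cong _ _ xs (λ x _ → eqFin-injective FinP.inject₁-injective i x))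

count-fromℕ-ι : ∀ {N} xs → count (eqFin (Fin.fromℕ N)) (map ι xs) ≡ 0
count-fromℕ-ι xs = trans (count-map _ ι xs) (count≡0 _ xs (λ x _ → ≢⇒eqFin≡false FinP.fromℕ≢inject₁))

clamp : ∀ {m} → Fin (suc (suc m)) → Fin (suc m)
clamp Fin.zero                = Fin.zero
clamp {zero}  (Fin.suc _)     = Fin.zero
clamp {suc m} (Fin.suc x)     = Fin.suc (clamp x)

clamp-ι : ∀ {m} (x : Fin (suc m)) → clamp (ι x) ≡ x
clamp-ι Fin.zero              = refl
clamp-ι {suc m} (Fin.suc x)   = cong Fin.suc (clamp-ι x)

ι-clamp : ∀ {m} (y : Fin (suc (suc m))) → ¬ y ≡ Fin.fromℕ (suc m) → ι (clamp y) ≡ y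
ι-clamp Fin.zero                      y≢top = refl
ι-clamp {zero}  (Fin.suc Fin.zero)    y≢top = ⊥-elim (y≢top refl)
ι-clamp {suc m} (Fin.suc y)           y≢top = cong Fin.suc (ι-clamp y (λ e → y≢top (cong Fin.suc e)))

ι-or-fromℕ : ∀ {N} (j : Fin (suc N)) → (∃ λ i → j ≡ ι i) ⊎ j ≡ Fin.fromℕ N
ι-or-fromℕ {zero}  Fin.zero    = inj₂ refl
ι-or-fromℕ {suc N} Fin.zero    = inj₁ (Fin.zero , refl)
ι-or-fromℕ {suc N} (Fin.suc j) with ι-or-fromℕ j
... | inj₁ (i , e) = inj₁ (Fin.suc i , cong Fin.suc e)
... | inj₂ e       = inj₂ (cong Fin.suc e)

SSYTᵇ : ∀ {N} → List ℕ → List (List (Fin N)) → Bool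
SSYTᵇ μ T = semistandard T ∧ hasContent μ T

map-length-map : ∀ {A B : Set} (f : A → B) (T : List (List A)) → map length (map (map f) T) ≡ map length T
map-length-map f []      = refl
map-length-map f (r ∷ T) = cong₂ _∷_ (LP.length-map f r) (map-length-map f T)

linked-tail : ∀ {x xs} → Linked _≥_ (x ∷ xs) → Linked _≥_ xs
linked-tail [-]      = []
linked-tail (_ ∷ lk) = lk

-- Λ₁≤m (that is λ₂ ≤ μ₁) keeps the whole second row under 1's, so prepending a 1 to the first
-- row preserves column strictness.
module KostkaStep (n m a : ℕ) (Λ M : List ℕ)
  (shape-decreasing : Linked _≥_ (a ∷ Λ)) (Λ₁≤m : part₁ Λ ≤ m) (top-unused : part M n ≡ 0) where

  N : ℕ
  N = suc n

  μ μ⁺ : List ℕ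
  μ  = m ∷ M
  μ⁺ = suc m ∷ M

  Tab Tab⁺ : Set
  Tab  = List (List (Fin N))
  Tab⁺ = List (List (Fin (suc N)))

  addOne : Tab → Tab⁺
  addOne []      = []
  addOne (r ∷ T) = (Fin.zero ∷ map ι r) ∷ map (map ι) T

  dropOne : Tab⁺ → Tab
  dropOne []            = []
  dropOne ([] ∷ T)      = [] ∷ map (map clamp) T
  dropOne ((x ∷ r) ∷ T) = map clamp r ∷ map (map clamp) T

  concat-addOne : ∀ r T → concat (addOne (r ∷ T)) ≡ Fin.zero ∷ map ι (concat (r ∷ T))
  concat-addOne r T = cong (Fin.zero ∷_) (trans (cong (map ι r ++_) (LP.concat-map T))
                                                (sym (LP.map-++ ι r (concat T))))

  addOne-Content : ∀ r T → Content μ (r ∷ T) → Content μ⁺ (addOne (r ∷ T))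
  addOne-Content r T h j with ι-or-fromℕ j
  ... | inj₁ (i , refl) = trans (cong (count (eqFin (ι i))) (concat-addOne r T)) (old i)
    where
    old : ∀ i → count (eqFin (ι i)) (Fin.zero ∷ map ι (concat (r ∷ T))) ≡ part μ⁺ (toℕ (ι i))
    old Fin.zero    = cong suc (trans (count-ι Fin.zero (concat (r ∷ T))) (h Fin.zero))
    old (Fin.suc i) = trans (count-ι (Fin.suc i) (concat (r ∷ T)))
                            (trans (h (Fin.suc i)) (cong (part M) (sym (FinP.toℕ-inject₁ i))))
  ... | inj₂ refl = begin
    count (eqFin (Fin.fromℕ N)) (concat (addOne (r ∷ T)))  ≡⟨ cong (count (eqFin (Fin.fromℕ N))) (concat-addOne r T) ⟩
    count (eqFin (Fin.fromℕ N)) (map ι (concat (r ∷ T)))   ≡⟨ count-fromℕ-ι (concat (r ∷ T)) ⟩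
    0                                                      ≡⟨ sym top-unused ⟩
    part M n                                               ≡⟨ cong (part μ⁺) (sym (FinP.toℕ-fromℕ N)) ⟩
    part μ⁺ (toℕ (Fin.fromℕ N))                            ∎
    where open ≡-Reasoning

  addOne-Content⁻ : ∀ r T → Content μ⁺ (addOne (r ∷ T)) → Content μ (r ∷ T)
  addOne-Content⁻ r T h i = old i (trans (sym (cong (count (eqFin (ι i))) (concat-addOne r T))) (h (ι i)))
    where
    old : ∀ i → count (eqFin (ι i)) (Fin.zero ∷ map ι (concat (r ∷ T))) ≡ part μ⁺ (toℕ (ι i)) →
          count (eqFin i) (concat (r ∷ T)) ≡ part μ (toℕ i)
    old Fin.zero    e = trans (sym (count-ι Fin.zero (concat (r ∷ T)))) (suc-injective e)
    old (Fin.suc i) e = trans (sym (count-ι (Fin.suc i) (concat (r ∷ T)))) (trans e (cong (part M) (FinP.toℕ-inject₁ i)))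

  all-rowWeak-addOne : ∀ r T → all rowWeak (addOne (r ∷ T)) ≡ all rowWeak (r ∷ T)
  all-rowWeak-addOne r T = cong₂ _∧_ (trans (rowWeak-zero∷ (map ι r)) (rowWeak-ι r)) (all-rowWeak-ι T)
    where
    rowWeak-zero∷ : ∀ (xs : List (Fin (suc N))) → rowWeak (Fin.zero ∷ xs) ≡ rowWeak xs
    rowWeak-zero∷ []      = refl
    rowWeak-zero∷ (y ∷ xs) = refl

  first-columns-strict : ∀ r s rs → rowWeak r ≡ true → NoZero s → colsStrict (s ∷ rs) ≡ true →
    Linked _≥_ (map length (s ∷ rs)) → length s ≡ part₁ Λ → count (eqFin Fin.zero) (concat (r ∷ s ∷ rs)) ≡ m →
    colStrict r s ≡ true × colStrict (Fin.zero ∷ map ι r) (map ι s) ≡ true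
  first-columns-strict r s rs r-weak s-pos cols lk s≡Λ₁ zeros =
    subst (λ z → colStrict z s ≡ true) (sym r≡) (colStrict-under-zeros m r′ s s≤m s-pos) ,
    subst (λ z → colStrict (Fin.zero ∷ map ι z) (map ι s) ≡ true) (sym r≡)
      (subst (λ z → colStrict (Fin.zero ∷ z) (map ι s) ≡ true) (sym (LP.map-++ ι (replicate m Fin.zero) r′))
        (subst (λ z → colStrict (Fin.zero ∷ z ++ map ι r′) (map ι s) ≡ true) (sym (LP.map-replicate ι m Fin.zero))
          (colStrict-under-zeros (suc m) (map ι r′) (map ι s) ιs≤1+m ιs-pos)))
    where
    zeros-below : count (eqFin Fin.zero) (concat (s ∷ rs)) ≡ 0
    zeros-below = count-zero-concat (s ∷ rs) λ where
      row (here refl)  → s-pos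
      row (there row∈) → colsStrict-lower-NoZero s rs cols lk row row∈
    zeros-in-r : count (eqFin Fin.zero) r ≡ m
    zeros-in-r = count-++-right≡0 (eqFin Fin.zero) r (concat (s ∷ rs)) zeros zeros-below
    r′ : List (Fin N)
    r′ = proj₁ (rowWeak-zeros-prefix r r-weak)
    r≡ : r ≡ replicate m Fin.zero ++ r′
    r≡ = subst (λ c → r ≡ replicate c Fin.zero ++ r′) zeros-in-r (proj₂ (rowWeak-zeros-prefix r r-weak))
    s≤m : length s ≤ m
    s≤m = ≤-trans (≤-reflexive s≡Λ₁) Λ₁≤m
    ιs≤1+m : length (map ι s) ≤ suc m
    ιs≤1+m = ≤-trans (≤-reflexive (LP.length-map ι s)) (≤-trans s≤m (n≤1+n m))
    ιs-pos : NoZero (map ι s)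
    ιs-pos y y∈ = let y′ , y′∈ , y≡ = ∈-map⁻ ι y∈
                  in subst (λ z → 0 < toℕ z) (sym y≡) (subst (0 <_) (sym (FinP.toℕ-inject₁ y′)) (s-pos y′ y′∈))

  module Shape {A : Set} {r s : List A} {rs : List (List A)} (sh : map length (r ∷ s ∷ rs) ≡ a ∷ Λ) where
    decreasing : Linked _≥_ (map length (r ∷ s ∷ rs))
    decreasing = subst (Linked _≥_) (sym sh) shape-decreasing

    lower-decreasing : Linked _≥_ (map length (s ∷ rs))
    lower-decreasing = linked-tail decreasing

    s≤r : length s ≤ length r
    s≤r with decreasing
    ... | le ∷ _ = le

    s≡Λ₁ : length s ≡ part₁ Λ
    s≡Λ₁ = cong part₁ (LP.∷-injectiveʳ sh)

  addOne-semistandard : ∀ r T → map length (r ∷ T) ≡ a ∷ Λ → semistandard (r ∷ T) ≡ true → Content μ (r ∷ T) →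
    semistandard (addOne (r ∷ T)) ≡ true
  addOne-semistandard r []       sh e c = ∧-true (trans (all-rowWeak-addOne r []) (∧-trueˡ e)) refl
  addOne-semistandard r (s ∷ rs) sh e c =
    ∧-true (trans (all-rowWeak-addOne r (s ∷ rs)) rows)
           (∧-true (proj₂ (first-columns-strict r s rs (∧-trueˡ rows) s-pos lower-cols lower-decreasing s≡Λ₁ (c Fin.zero)))
                   (trans (colsStrict-ι (s ∷ rs)) lower-cols))
    where
    open Shape {r = r} {s} {rs} sh
    rows : all rowWeak (r ∷ s ∷ rs) ≡ true
    rows = ∧-trueˡ e
    cols : colsStrict (r ∷ s ∷ rs) ≡ true
    cols = ∧-trueʳ {all rowWeak (r ∷ s ∷ rs)} e
    lower-cols : colsStrict (s ∷ rs) ≡ true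
    lower-cols = ∧-trueʳ {colStrict r s} cols
    s-pos : NoZero s
    s-pos = colStrict-below-NoZero r s (∧-trueˡ cols) s≤r

  addOne-semistandard⁻ : ∀ r T → map length (r ∷ T) ≡ a ∷ Λ → semistandard (addOne (r ∷ T)) ≡ true → Content μ (r ∷ T) →
    semistandard (r ∷ T) ≡ true
  addOne-semistandard⁻ r []       sh e c = ∧-true (trans (sym (all-rowWeak-addOne r [])) (∧-trueˡ e)) refl
  addOne-semistandard⁻ r (s ∷ rs) sh e c =
    ∧-true rows (∧-true (proj₁ (first-columns-strict r s rs (∧-trueˡ rows) s-pos lower-cols lower-decreasing s≡Λ₁ (c Fin.zero)))
                        lower-cols)
    where
    open Shape {r = r} {s} {rs} sh
    rows : all rowWeak (r ∷ s ∷ rs) ≡ true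
    rows = trans (sym (all-rowWeak-addOne r (s ∷ rs))) (∧-trueˡ e)
    cols : colsStrict (addOne (r ∷ s ∷ rs)) ≡ true
    cols = ∧-trueʳ {all rowWeak (addOne (r ∷ s ∷ rs))} e
    lower-cols : colsStrict (s ∷ rs) ≡ true
    lower-cols = trans (sym (colsStrict-ι (s ∷ rs))) (∧-trueʳ {colStrict (Fin.zero ∷ map ι r) (map ι s)} cols)
    ιs≤ : length (map ι s) ≤ length (Fin.zero ∷ map ι r)
    ιs≤ = subst₂ _≤_ (sym (LP.length-map ι s)) (sym (cong suc (LP.length-map ι r))) (≤-trans s≤r (n≤1+n _))
    s-pos : NoZero s
    s-pos y y∈ = subst (0 <_) (FinP.toℕ-inject₁ y)
                   (colStrict-below-NoZero (Fin.zero ∷ map ι r) (map ι s) (∧-trueˡ cols) ιs≤ (ι y) (∈-map⁺ ι y∈))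

  dropOne-addOne : ∀ T → dropOne (addOne T) ≡ T
  dropOne-addOne []      = refl
  dropOne-addOne (r ∷ T) = cong₂ _∷_ (clamp∘ι r) (trans (sym (LP.map-∘ T)) (LP.map-id-local (All.tabulate (λ {row} _ → clamp∘ι row))))
    where
    clamp∘ι : (row : List (Fin N)) → map clamp (map ι row) ≡ row
    clamp∘ι row = trans (sym (LP.map-∘ row)) (LP.map-id-local (All.tabulate (λ {x} _ → clamp-ι x)))

  addOne-dropOne : ∀ T′ → T′ ∈ tableaux (suc N) (suc a ∷ Λ) → SSYTᵇ μ⁺ T′ ≡ true → addOne (dropOne T′) ≡ T′
  addOne-dropOne []             T′∈ e with () ← tableaux-sound (suc N) (suc a ∷ Λ) T′∈
  addOne-dropOne ([] ∷ T)       T′∈ e = ⊥-elim (0≢1+n (LP.∷-injectiveˡ (tableaux-sound (suc N) (suc a ∷ Λ) T′∈)))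
  addOne-dropOne ((x ∷ r) ∷ T)  T′∈ e =
    cong₂ _∷_ (cong₂ _∷_ (sym x≡0) (ι∘clamp (λ y y∈ → there (∈-++⁺ˡ y∈))))
              (trans (sym (LP.map-∘ T))
                     (LP.map-id-local (All.tabulate (λ row∈ → ι∘clamp (λ y y∈ → ∈-++⁺ʳ (x ∷ r) (∈-concat⁺′ y∈ row∈))))))
    where
    T′ : Tab⁺
    T′ = (x ∷ r) ∷ T
    sh : map length T′ ≡ suc a ∷ Λ
    sh = tableaux-sound (suc N) (suc a ∷ Λ) T′∈
    ss : semistandard T′ ≡ true
    ss = ∧-trueˡ e
    content : Content μ⁺ T′
    content = hasContent⇒Content μ⁺ T′ (∧-trueʳ {semistandard T′} e)
    not-top : ∀ y → y ∈ concat T′ → ¬ y ≡ Fin.fromℕ N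
    not-top y y∈ refl = false≢true (trans (sym (count≡0⇒false _ (concat T′) top-absent y y∈)) (≡⇒eqFin≡true {x = Fin.fromℕ N} refl))
      where
      top-absent : count (eqFin (Fin.fromℕ N)) (concat T′) ≡ 0
      top-absent = trans (content (Fin.fromℕ N)) (trans (cong (part μ⁺) (FinP.toℕ-fromℕ N)) top-unused)
    ι∘clamp : ∀ {row} → (∀ y → y ∈ row → y ∈ concat T′) → map ι (map clamp row) ≡ row
    ι∘clamp {row} sub = trans (sym (LP.map-∘ row)) (LP.map-id-local (All.tabulate (λ {y} y∈ → ι-clamp y (not-top y (sub y y∈)))))
    decreasing⁺ : Linked _≥_ (map length T′)
    decreasing⁺ = subst (Linked _≥_) (sym sh) (grow shape-decreasing)
      where
      grow : Linked _≥_ (a ∷ Λ) → Linked _≥_ (suc a ∷ Λ)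
      grow [-]      = [-]
      grow (l ∷ ls) = ≤-trans l (n≤1+n a) ∷ ls
    zeros-below : count (eqFin Fin.zero) (concat T) ≡ 0
    zeros-below = count-zero-concat T (colsStrict-lower-NoZero (x ∷ r) T (∧-trueʳ {all rowWeak T′} ss) decreasing⁺)
    zeros-in-first : count (eqFin Fin.zero) (x ∷ r) ≡ suc m
    zeros-in-first = count-++-right≡0 (eqFin Fin.zero) (x ∷ r) (concat T) (content Fin.zero) zeros-below
    x≡0 : x ≡ Fin.zero
    x≡0 with rowWeak-zeros-prefix (x ∷ r) (∧-trueˡ {rowWeak (x ∷ r)} (∧-trueˡ ss))
    ... | r′ , r≡ rewrite zeros-in-first = LP.∷-injectiveˡ r≡

  addOne-embeds : Embeds (SSYTᵇ μ) (tableaux N (a ∷ Λ)) (SSYTᵇ μ⁺) (tableaux (suc N) (suc a ∷ Λ)) addOne dropOne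
  addOne-embeds []      T∈ e with () ← tableaux-sound N (a ∷ Λ) T∈
  addOne-embeds (r ∷ T) T∈ e =
    (subst (λ sh → addOne (r ∷ T) ∈ tableaux (suc N) sh) shape⁺ (tableaux-complete (suc N) (addOne (r ∷ T))) ,
     ∧-true (addOne-semistandard r T sh (∧-trueˡ e) content) (Content⇒hasContent μ⁺ (addOne (r ∷ T)) (addOne-Content r T content))) ,
    dropOne-addOne (r ∷ T)
    where
    sh : map length (r ∷ T) ≡ a ∷ Λ
    sh = tableaux-sound N (a ∷ Λ) T∈
    content : Content μ (r ∷ T)
    content = hasContent⇒Content μ (r ∷ T) (∧-trueʳ {semistandard (r ∷ T)} e)
    shape⁺ : map length (addOne (r ∷ T)) ≡ suc a ∷ Λ
    shape⁺ = cong₂ _∷_ (cong suc (trans (LP.length-map ι r) (LP.∷-injectiveˡ sh)))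
                       (trans (map-length-map ι T) (LP.∷-injectiveʳ sh))

  dropOne-embeds : Embeds (SSYTᵇ μ⁺) (tableaux (suc N) (suc a ∷ Λ)) (SSYTᵇ μ) (tableaux N (a ∷ Λ)) dropOne addOne
  dropOne-embeds []            T′∈ e with () ← tableaux-sound (suc N) (suc a ∷ Λ) T′∈
  dropOne-embeds ([] ∷ T)      T′∈ e = ⊥-elim (0≢1+n (LP.∷-injectiveˡ (tableaux-sound (suc N) (suc a ∷ Λ) T′∈)))
  dropOne-embeds ((x ∷ r) ∷ T) T′∈ e =
    (subst (λ sh → dropOne T′ ∈ tableaux N sh) shape (tableaux-complete N (dropOne T′)) ,
     ∧-true (addOne-semistandard⁻ (map clamp r) (map (map clamp) T) shape (∧-trueˡ e′) content)
            (Content⇒hasContent μ (dropOne T′) content)) ,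
    addOne∘dropOne
    where
    T′ : Tab⁺
    T′ = (x ∷ r) ∷ T
    addOne∘dropOne : addOne (dropOne T′) ≡ T′
    addOne∘dropOne = addOne-dropOne T′ T′∈ e
    sh : map length T′ ≡ suc a ∷ Λ
    sh = tableaux-sound (suc N) (suc a ∷ Λ) T′∈
    shape : map length (dropOne T′) ≡ a ∷ Λ
    shape = cong₂ _∷_ (trans (LP.length-map clamp r) (suc-injective (LP.∷-injectiveˡ sh)))
                      (trans (map-length-map clamp T) (LP.∷-injectiveʳ sh))
    e′ : SSYTᵇ μ⁺ (addOne (dropOne T′)) ≡ true
    e′ = trans (cong (SSYTᵇ μ⁺) addOne∘dropOne) e
    content : Content μ (dropOne T′)
    content = addOne-Content⁻ (map clamp r) (map (map clamp) T)
                (hasContent⇒Content μ⁺ (addOne (dropOne T′)) (∧-trueʳ {semistandard (addOne (dropOne T′))} e′))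

  kostka-addOne : kostka N (a ∷ Λ) μ ≡ kostka (suc N) (suc a ∷ Λ) μ⁺
  kostka-addOne = begin
    kostka N (a ∷ Λ) μ                                  ≡⟨ length-filterᵇ (SSYTᵇ μ) (tableaux N (a ∷ Λ)) ⟩
    count (SSYTᵇ μ) (tableaux N (a ∷ Λ))                ≡⟨ count-≡ _ _ addOne dropOne _ _ (tableaux-unique N (a ∷ Λ))
                                                             (tableaux-unique (suc N) (suc a ∷ Λ)) addOne-embeds dropOne-embeds ⟩
    count (SSYTᵇ μ⁺) (tableaux (suc N) (suc a ∷ Λ))     ≡⟨ sym (length-filterᵇ (SSYTᵇ μ⁺) (tableaux (suc N) (suc a ∷ Λ))) ⟩
    kostka (suc N) (suc a ∷ Λ) μ⁺                       ∎
    where open ≡-Reasoning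

eventually-constant : ∀ {A : Set} (f : ℕ → A) m → (∀ N → m < N → f N ≡ f (suc N)) →
  ∀ {n n′} → m < n → m < n′ → f n ≡ f n′
eventually-constant f m step m<n m<n′ = trans (to-base m<n) (sym (to-base m<n′))
  where
  from-base : ∀ d → f (suc m + d) ≡ f (suc m)
  from-base zero    = cong f (+-identityʳ (suc m))
  from-base (suc d) = begin
    f (suc m + suc d)    ≡⟨ cong f (+-suc (suc m) d) ⟩
    f (suc (suc m + d))  ≡⟨ sym (step (suc m + d) (s≤s (m≤m+n m d))) ⟩
    f (suc m + d)        ≡⟨ from-base d ⟩
    f (suc m)            ∎
    where open ≡-Reasoning
  to-base : ∀ {N} → m < N → f N ≡ f (suc m)
  to-base {N} m<N = trans (cong f (sym (m+[n∸m]≡n m<N))) (from-base (N ∸ suc m))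

part-beyond-length : ∀ (l : List ℕ) j → length l ≤ j → part l j ≡ 0
part-beyond-length []      j       le       = refl
part-beyond-length (x ∷ l) (suc j) (s≤s le) = part-beyond-length l j le

length≤sum : ∀ (l : List ℕ) → All (λ a → 0 < a) l → length l ≤ sum l
length≤sum []      []         = z≤n
length≤sum (x ∷ l) (x>0 ∷ l>0) = +-mono-≤ x>0 (length≤sum l l>0)

kostka-withHead-suc : ∀ {k} N {Λ M} → 2 * k < N → SmallPartition k Λ → SmallPartition k M →
  kostka N (withHead N Λ) (withHead N M) ≡ kostka (suc N) (withHead (suc N) Λ) (withHead (suc N) M)
kostka-withHead-suc {k} (suc n) {Λ} {M} 2k<N Λ-small M-small =
  trans (KostkaStep.kostka-addOne n (N ∸ sum M) (N ∸ sum Λ) Λ M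
           (withHead-decreasing Λ 2k<N Λ-small) Λ₁≤m top-unused)
        (cong₂ (λ x y → kostka (suc N) (x ∷ Λ) (y ∷ M)) (sym (+-∸-assoc 1 Λ≤N)) (sym (+-∸-assoc 1 M≤N)))
  where
  N : ℕ
  N = suc n
  open SmallPartition Λ-small renaming (small to Λ≤k)
  open SmallPartition M-small renaming (small to M≤k; positive to M-positive)
  Λ≤N : sum Λ ≤ N
  Λ≤N = ≤-trans Λ≤k (<⇒≤ (k<n {k} 2k<N))
  M≤N : sum M ≤ N
  M≤N = ≤-trans M≤k (<⇒≤ (k<n {k} 2k<N))
  Λ₁≤m : part₁ Λ ≤ N ∸ sum M
  Λ₁≤m = ≤-trans (≤-trans (head≤sum Λ) Λ≤k) (<⇒≤ (k<withHead M 2k<N M≤k))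
  top-unused : part M n ≡ 0
  top-unused = part-beyond-length M n (≤-trans (length≤sum M M-positive) (≤-trans M≤k (≤-pred (k<n {k} 2k<N))))

kostka-withHead-stable : ∀ {k n n′ Λ M} → 2 * k < n → 2 * k < n′ → SmallPartition k Λ → SmallPartition k M →
  kostka n (withHead n Λ) (withHead n M) ≡ kostka n′ (withHead n′ Λ) (withHead n′ M)
kostka-withHead-stable {k} {Λ = Λ} {M} 2k<n 2k<n′ Λ-small M-small =
  eventually-constant (λ N → kostka N (withHead N Λ) (withHead N M)) (2 * k)
    (λ N 2k<N → kostka-withHead-suc N 2k<N Λ-small M-small) 2k<n 2k<n′

kostka-star : ∀ {k n n′} → 2 * k < n → 2 * k < n′ → (λ′ μ : List ℕ) → 𝓕 n k λ′ → 𝓕 n k μ →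
  kostka n λ′ μ ≡ kostka n′ (star n n′ λ′) (star n n′ μ)
kostka-star {k} {n} {n′} 2k<n 2k<n′ λ′ μ λ′∈𝓕 μ∈𝓕
  with 𝓕-withHead λ′ (k<n {k} 2k<n) λ′∈𝓕 | 𝓕-withHead μ (k<n {k} 2k<n) μ∈𝓕
... | Λ , Λ-small , refl | M , M-small , refl =
  trans (kostka-withHead-stable 2k<n 2k<n′ Λ-small M-small)
        (sym (cong₂ (kostka n′) (star-withHead-small {k} 2k<n 2k<n′ Λ-small) (star-withHead-small {k} 2k<n 2k<n′ M-small)))

allZero : ∀ {r} → Vec ℕ r → Bool
allZero []      = true
allZero (x ∷ t) = (x ≡ᵇ 0) ∧ allZero t

place : ∀ {r} → ℕ → Fin r → (Vec ℕ r → ℕ) → Vec ℕ r → ℕ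
place l x k t = when (l ≤ᵇ Vec.lookup t x) (k (Vec.updateAt t x (_∸ l)))

-- The number of ways to put items of sizes L into rows of capacities t, filling every row exactly.
fillings : ∀ {r} → List ℕ → Vec ℕ r → ℕ
fillings     []      t = when (allZero t) 1
fillings {r} (l ∷ L) t = sumBy (λ x → place l x (fillings L) t) (allFin r)

place-comm : ∀ {r} a b (x y : Fin r) (k : Vec ℕ r → ℕ) t → place a x (place b y k) t ≡ place b y (place a x k) t
place-comm a b x y k t with x Fin.≟ y
... | yes refl = begin
  when (a ≤ᵇ tx) (when (b ≤ᵇ Vec.lookup (Vec.updateAt t x (_∸ a)) x) (k (Vec.updateAt (Vec.updateAt t x (_∸ a)) x (_∸ b))))
    ≡⟨ cong₂ (λ u v → when (a ≤ᵇ tx) (when (b ≤ᵇ u) (k v))) (VP.lookup∘updateAt x t) (merge a b) ⟩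
  when (a ≤ᵇ tx) (when (b ≤ᵇ tx ∸ a) (k (Vec.updateAt t x (_∸ (a + b)))))
    ≡⟨ when-when a b tx _ ⟩
  when (a + b ≤ᵇ tx) (k (Vec.updateAt t x (_∸ (a + b))))
    ≡⟨ cong (λ s → when (s ≤ᵇ tx) (k (Vec.updateAt t x (_∸ s)))) (+-comm a b) ⟩
  when (b + a ≤ᵇ tx) (k (Vec.updateAt t x (_∸ (b + a))))
    ≡⟨ sym (when-when b a tx _) ⟩
  when (b ≤ᵇ tx) (when (a ≤ᵇ tx ∸ b) (k (Vec.updateAt t x (_∸ (b + a)))))
    ≡⟨ sym (cong₂ (λ u v → when (b ≤ᵇ tx) (when (a ≤ᵇ u) (k v))) (VP.lookup∘updateAt x t) (merge b a)) ⟩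
  when (b ≤ᵇ tx) (when (a ≤ᵇ Vec.lookup (Vec.updateAt t x (_∸ b)) x) (k (Vec.updateAt (Vec.updateAt t x (_∸ b)) x (_∸ a)))) ∎
  where
  open ≡-Reasoning
  tx : ℕ
  tx = Vec.lookup t x
  merge : ∀ c d → Vec.updateAt (Vec.updateAt t x (_∸ c)) x (_∸ d) ≡ Vec.updateAt t x (_∸ (c + d))
  merge c d = trans (VP.updateAt-updateAt x t) (VP.updateAt-cong x (λ z → ∸-+-assoc z c d) t)
... | no x≢y = begin
  when (a ≤ᵇ Vec.lookup t x) (when (b ≤ᵇ Vec.lookup (Vec.updateAt t x (_∸ a)) y) (k (Vec.updateAt (Vec.updateAt t x (_∸ a)) y (_∸ b))))
    ≡⟨ cong (λ u → when (a ≤ᵇ Vec.lookup t x) (when (b ≤ᵇ u) (k (Vec.updateAt (Vec.updateAt t x (_∸ a)) y (_∸ b)))))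
            (VP.lookup∘updateAt′ y x (λ e → x≢y (sym e)) t) ⟩
  when (a ≤ᵇ Vec.lookup t x) (when (b ≤ᵇ Vec.lookup t y) (k (Vec.updateAt (Vec.updateAt t x (_∸ a)) y (_∸ b))))
    ≡⟨ when-comm (a ≤ᵇ Vec.lookup t x) (b ≤ᵇ Vec.lookup t y) _ ⟩
  when (b ≤ᵇ Vec.lookup t y) (when (a ≤ᵇ Vec.lookup t x) (k (Vec.updateAt (Vec.updateAt t x (_∸ a)) y (_∸ b))))
    ≡⟨ cong₂ (λ u v → when (b ≤ᵇ Vec.lookup t y) (when (a ≤ᵇ u) (k v)))
             (sym (VP.lookup∘updateAt′ x y x≢y t)) (VP.updateAt-commutes y x (λ e → x≢y (sym e)) t) ⟩
  when (b ≤ᵇ Vec.lookup t y) (when (a ≤ᵇ Vec.lookup (Vec.updateAt t y (_∸ b)) x) (k (Vec.updateAt (Vec.updateAt t y (_∸ b)) x (_∸ a)))) ∎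
  where open ≡-Reasoning

fillings-swap : ∀ {r} a b L (t : Vec ℕ r) → fillings (a ∷ b ∷ L) t ≡ fillings (b ∷ a ∷ L) t
fillings-swap {r} a b L t = begin
  sumBy (λ x → when (a ≤ᵇ Vec.lookup t x) (sumBy (λ y → place b y (fillings L) _) (allFin r))) (allFin r)
    ≡⟨ sumBy-cong _ _ (allFin r) (λ x _ → when-sumBy _ _ (allFin r)) ⟩
  sumBy (λ x → sumBy (λ y → place a x (place b y (fillings L)) t) (allFin r)) (allFin r)
    ≡⟨ sumBy-swap _ (allFin r) (allFin r) ⟩
  sumBy (λ y → sumBy (λ x → place a x (place b y (fillings L)) t) (allFin r)) (allFin r)
    ≡⟨ sumBy-cong _ _ (allFin r) (λ y _ → sumBy-cong _ _ (allFin r) (λ x _ → place-comm a b x y (fillings L) t)) ⟩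
  sumBy (λ y → sumBy (λ x → place b y (place a x (fillings L)) t) (allFin r)) (allFin r)
    ≡⟨ sym (sumBy-cong _ _ (allFin r) (λ y _ → when-sumBy _ _ (allFin r))) ⟩
  sumBy (λ y → when (b ≤ᵇ Vec.lookup t y) (sumBy (λ x → place a x (fillings L) _) (allFin r))) (allFin r) ∎
  where open ≡-Reasoning

fillings-∷-cong : ∀ {r} (L L′ : List ℕ) → (∀ (t : Vec ℕ r) → fillings L t ≡ fillings L′ t) →
  ∀ l t → fillings (l ∷ L) t ≡ fillings (l ∷ L′) t
fillings-∷-cong {r} L L′ L≗L′ l t =
  sumBy-cong (λ x → place l x (fillings L) t) (λ x → place l x (fillings L′) t) (allFin r)
             (λ x _ → cong (when (l ≤ᵇ Vec.lookup t x)) (L≗L′ (Vec.updateAt t x (_∸ l))))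

fillings-↭ : ∀ {r} {L L′ : List ℕ} → L ↭ L′ → (t : Vec ℕ r) → fillings L t ≡ fillings L′ t
fillings-↭ ↭.refl                              t = refl
fillings-↭ (↭.prep {xs = L} {ys = L′} l p)     t = fillings-∷-cong L L′ (fillings-↭ p) l t
fillings-↭ {r} (↭.swap {xs = L} {ys = L′} a b p) t =
  trans (fillings-swap a b L t) (fillings-∷-cong {r} (a ∷ L) (a ∷ L′) (fillings-∷-cong {r} L L′ (fillings-↭ p) a) b t)
fillings-↭ (↭.trans p q)                       t = trans (fillings-↭ p t) (fillings-↭ q t)

insertDesc-↭ : ∀ a l → insertDesc a l ↭ a ∷ l
insertDesc-↭ a []      = ↭.refl
insertDesc-↭ a (b ∷ l) with b ≤ᵇ a
... | true  = ↭.refl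
... | false = ↭.trans (↭.prep b (insertDesc-↭ a l)) (↭.swap b a ↭.refl)

sortDesc-↭ : ∀ l → sortDesc l ↭ l
sortDesc-↭ []      = ↭.refl
sortDesc-↭ (a ∷ l) = ↭.trans (insertDesc-↭ a (sortDesc l)) (↭.prep a (sortDesc-↭ l))

∸-∸-cancel : ∀ N t u → t ≤ u → u ≤ N → (N ∸ t) ∸ (N ∸ u) ≡ u ∸ t
∸-∸-cancel N t u t≤u u≤N = begin
  (N ∸ t) ∸ (N ∸ u)                          ≡⟨ cong (λ z → (z ∸ t) ∸ (N ∸ u)) (sym N≡) ⟩
  ((N ∸ u) + (u ∸ t) + t) ∸ t ∸ (N ∸ u)      ≡⟨ cong (_∸ (N ∸ u)) (m+n∸n≡m ((N ∸ u) + (u ∸ t)) t) ⟩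
  (N ∸ u) + (u ∸ t) ∸ (N ∸ u)                ≡⟨ m+n∸m≡n (N ∸ u) (u ∸ t) ⟩
  u ∸ t                                      ∎
  where
  open ≡-Reasoning
  N≡ : (N ∸ u) + (u ∸ t) + t ≡ N
  N≡ = trans (+-assoc (N ∸ u) (u ∸ t) t) (trans (cong ((N ∸ u) +_) (m∸n+n≡m t≤u)) (m∸n+n≡m u≤N))

-- A cycle longer than k fits into no row of capacity ≤ k, so it must go into the first row.
fillings-large-head : ∀ {r k} N t u M (V : Vec ℕ r) → 2 * k < N → t ≤ k → u ≤ k → (∀ y → Vec.lookup V y ≤ k) →
  fillings ((N ∸ u) ∷ M) ((N ∸ t) ∷ V) ≡ when (t ≤ᵇ u) (fillings M ((u ∸ t) ∷ V))
fillings-large-head {r} {k} N t u M V 2k<N t≤k u≤k V≤k = trans (cong₂ _+_ first-row other-rows) (+-identityʳ _)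
  where
  k≤N : k ≤ N
  k≤N = <⇒≤ (k<n {k} 2k<N)
  k<N∸u : k < N ∸ u
  k<N∸u = <-≤-trans (k<n∸k 2k<N) (∸-monoʳ-≤ N u≤k)
  first-row : place (N ∸ u) Fin.zero (fillings M) ((N ∸ t) ∷ V) ≡ when (t ≤ᵇ u) (fillings M ((u ∸ t) ∷ V))
  first-row with t ≤? u
  ... | yes t≤u rewrite ≤⇒≤ᵇ≡true t≤u | ≤⇒≤ᵇ≡true (∸-monoʳ-≤ N t≤u) | ∸-∸-cancel N t u t≤u (≤-trans u≤k k≤N) = refl
  ... | no t≰u  rewrite ≰⇒≤ᵇ≡false t≰u
                      | ≰⇒≤ᵇ≡false {N ∸ u} {N ∸ t} (<⇒≱ (∸-monoʳ-< (≰⇒> t≰u) (≤-trans t≤k k≤N))) = refl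
  other-rows : sumBy (λ x → place (N ∸ u) x (fillings M) ((N ∸ t) ∷ V)) (Data.List.tabulate {n = r} Fin.suc) ≡ 0
  other-rows = sumBy≡0 _ _ (λ x x∈ → too-small x (∈-tabulate⁻ x∈))
    where
    too-small : ∀ x → (∃ λ i → x ≡ Fin.suc i) → place (N ∸ u) x (fillings M) ((N ∸ t) ∷ V) ≡ 0
    too-small .(Fin.suc i) (i , refl)
      rewrite ≰⇒≤ᵇ≡false {N ∸ u} {Vec.lookup V i} (λ le → <⇒≱ k<N∸u (≤-trans le (V≤k i))) = refl

load : ∀ {r} c (ℓ : Fin c → ℕ) (a : Vec (Fin r) c) (i : Fin r) → ℕ
load zero    ℓ []      i = 0
load (suc c) ℓ (x ∷ a) i = when (eqFin x i) (ℓ Fin.zero) + load c (λ j → ℓ (Fin.suc j)) a i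

fills : ∀ {r} c (ℓ : Fin c → ℕ) (t : Vec ℕ r) (a : Vec (Fin r) c) → Bool
fills {r} c ℓ t a = all (λ i → load c ℓ a i ≡ᵇ Vec.lookup t i) (allFin r)

allZero⁻ : ∀ {r} (t : Vec ℕ r) → allZero t ≡ true → ∀ i → Vec.lookup t i ≡ 0
allZero⁻ (x ∷ t) e Fin.zero    = ≡ᵇ≡true⇒≡ (∧-trueˡ e)
allZero⁻ (x ∷ t) e (Fin.suc i) = allZero⁻ t (∧-trueʳ {x ≡ᵇ 0} e) i

allZero⁺ : ∀ {r} (t : Vec ℕ r) → (∀ i → Vec.lookup t i ≡ 0) → allZero t ≡ true
allZero⁺ []      h = refl
allZero⁺ (x ∷ t) h = ∧-true (≡⇒≡ᵇ≡true (h Fin.zero)) (allZero⁺ t (λ i → h (Fin.suc i)))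

fills-[] : ∀ {r} (ℓ : Fin 0 → ℕ) (t : Vec ℕ r) → fills 0 ℓ t [] ≡ allZero t
fills-[] {r} ℓ t = ≡-from-⇔
  (λ e → allZero⁺ t (λ i → sym (≡ᵇ≡true⇒≡ (allFin-true⁻ (λ i → 0 ≡ᵇ Vec.lookup t i) e i))))
  (λ e → allFin-true⁺ (λ i → 0 ≡ᵇ Vec.lookup t i) (λ i → ≡⇒≡ᵇ≡true (sym (allZero⁻ t e i))))

fills-∷ : ∀ {r} c (ℓ : Fin (suc c) → ℕ) (t : Vec ℕ r) x a →
  fills (suc c) ℓ t (x ∷ a) ≡ (ℓ Fin.zero ≤ᵇ Vec.lookup t x) ∧ fills c (λ j → ℓ (Fin.suc j)) (Vec.updateAt t x (_∸ ℓ Fin.zero)) a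
fills-∷ {r} c ℓ t x a = ≡-from-⇔ forward backward
  where
  l : ℕ
  l = ℓ Fin.zero
  ℓ′ : Fin c → ℕ
  ℓ′ j = ℓ (Fin.suc j)
  w : Fin r → ℕ
  w = load c ℓ′ a
  t′ : Vec ℕ r
  t′ = Vec.updateAt t x (_∸ l)
  off-x : ∀ {i} → ¬ x ≡ i → when (eqFin x i) l + w i ≡ w i
  off-x {i} x≢i = cong (λ b → when b l + w i) (≢⇒eqFin≡false x≢i)
  t′-off-x : ∀ {i} → ¬ x ≡ i → Vec.lookup t′ i ≡ Vec.lookup t i
  t′-off-x x≢i = VP.lookup∘updateAt′ _ x (λ e → x≢i (sym e)) t
  forward : fills (suc c) ℓ t (x ∷ a) ≡ true → (l ≤ᵇ Vec.lookup t x) ∧ fills c ℓ′ t′ a ≡ true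
  forward e = ∧-true (≤⇒≤ᵇ≡true l≤tx) (allFin-true⁺ _ (λ i → ≡⇒≡ᵇ≡true (rest i)))
    where
    h : ∀ i → when (eqFin x i) l + w i ≡ Vec.lookup t i
    h i = ≡ᵇ≡true⇒≡ (allFin-true⁻ _ e i)
    hx : l + w x ≡ Vec.lookup t x
    hx = trans (cong (λ b → when b l + w x) (sym (≡⇒eqFin≡true {x = x} refl))) (h x)
    l≤tx : l ≤ Vec.lookup t x
    l≤tx = subst (l ≤_) hx (m≤m+n l (w x))
    rest : ∀ i → w i ≡ Vec.lookup t′ i
    rest i with x Fin.≟ i
    ... | yes refl = sym (trans (VP.lookup∘updateAt x t) (trans (cong (_∸ l) (sym hx)) (m+n∸m≡n l (w x))))
    ... | no x≢i   = trans (trans (sym (off-x x≢i)) (h i)) (sym (t′-off-x x≢i))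
  backward : (l ≤ᵇ Vec.lookup t x) ∧ fills c ℓ′ t′ a ≡ true → fills (suc c) ℓ t (x ∷ a) ≡ true
  backward e = allFin-true⁺ _ (λ i → ≡⇒≡ᵇ≡true (whole i))
    where
    h : ∀ i → w i ≡ Vec.lookup t′ i
    h i = ≡ᵇ≡true⇒≡ (allFin-true⁻ _ (∧-trueʳ {l ≤ᵇ Vec.lookup t x} e) i)
    whole : ∀ i → when (eqFin x i) l + w i ≡ Vec.lookup t i
    whole i with x Fin.≟ i
    ... | yes refl = trans (cong (l +_) (trans (h x) (VP.lookup∘updateAt x t))) (m+[n∸m]≡n (≤ᵇ≡true⇒≤ {l} (∧-trueˡ e)))
    ... | no x≢i   = trans (h i) (t′-off-x x≢i)

count-fills≡fillings : ∀ {r} c (ℓ : Fin c → ℕ) (t : Vec ℕ r) →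
  count (fills c ℓ t) (allVecs r c) ≡ fillings (Data.List.tabulate ℓ) t
count-fills≡fillings zero ℓ t = cong (λ b → when b 1) (fills-[] ℓ t)
count-fills≡fillings {r} (suc c) ℓ t =
  trans (count-concatMap (fills (suc c) ℓ t) (λ x → map (x Vec.∷_) (allVecs r c)) (allFin r))
    (sumBy-cong _ _ (allFin r) (λ x _ → begin
      count (fills (suc c) ℓ t) (map (x Vec.∷_) (allVecs r c))
        ≡⟨ count-map (fills (suc c) ℓ t) (x Vec.∷_) (allVecs r c) ⟩
      count (λ a → fills (suc c) ℓ t (x ∷ a)) (allVecs r c)
        ≡⟨ count-cong _ _ (allVecs r c) (λ a _ → fills-∷ c ℓ t x a) ⟩
      count (λ a → (l ≤ᵇ Vec.lookup t x) ∧ fills c ℓ′ (t′ x) a) (allVecs r c)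
        ≡⟨ count-∧ (l ≤ᵇ Vec.lookup t x) _ (allVecs r c) ⟩
      when (l ≤ᵇ Vec.lookup t x) (count (fills c ℓ′ (t′ x)) (allVecs r c))
        ≡⟨ cong (when (l ≤ᵇ Vec.lookup t x)) (count-fills≡fillings c ℓ′ (t′ x)) ⟩
      place l x (fillings (Data.List.tabulate ℓ′)) t ∎))
  where
  open ≡-Reasoning
  l : ℕ
  l = ℓ Fin.zero
  ℓ′ : Fin c → ℕ
  ℓ′ j = ℓ (Fin.suc j)
  t′ : Fin r → Vec ℕ r
  t′ x = Vec.updateAt t x (_∸ l)

load-tabulate : ∀ {r} c (ℓ : Fin c → ℕ) (h : Fin c → Fin r) i →
  load c ℓ (Vec.tabulate h) i ≡ sumBy (λ j → when (eqFin (h j) i) (ℓ j)) (allFin c)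
load-tabulate zero    ℓ h i = refl
load-tabulate (suc c) ℓ h i = cong (when (eqFin (h Fin.zero) i) (ℓ Fin.zero) +_)
  (trans (load-tabulate c (λ j → ℓ (Fin.suc j)) (λ j → h (Fin.suc j)) i)
         (sym (sumBy-tabulate (λ j → when (eqFin (h j) i) (ℓ j)) Fin.suc)))

module Cycles {n : ℕ} (σ : Permutation′ n) where

  next : Fin n → Fin n
  next x = σ ⟨$⟩ʳ x

  σ^ : ℕ → Fin n → Fin n
  σ^ = iter σ

  next-injective : ∀ {x y} → next x ≡ next y → x ≡ y
  next-injective {x} {y} e = trans (sym (inverseˡ σ)) (trans (cong (σ ⟨$⟩ˡ_) e) (inverseˡ σ))

  σ^-+ : ∀ m p x → σ^ (m + p) x ≡ σ^ m (σ^ p x)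
  σ^-+ zero    p x = refl
  σ^-+ (suc m) p x = cong next (σ^-+ m p x)

  σ^-injective : ∀ m {x y} → σ^ m x ≡ σ^ m y → x ≡ y
  σ^-injective zero    e = e
  σ^-injective (suc m) e = σ^-injective m (next-injective e)

  σ^-*-fixed : ∀ p x → σ^ p x ≡ x → ∀ q → σ^ (q * p) x ≡ x
  σ^-*-fixed p x e zero    = refl
  σ^-*-fixed p x e (suc q) = trans (σ^-+ p (q * p) x) (trans (cong (σ^ p) (σ^-*-fixed p x e q)) e)

  σ^-% : ∀ p x → σ^ (suc p) x ≡ x → ∀ m → σ^ m x ≡ σ^ (m % suc p) x
  σ^-% p x e m = begin
    σ^ m x                                         ≡⟨ cong (λ z → σ^ z x) (m≡m%n+[m/n]*n m (suc p)) ⟩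
    σ^ (m % suc p + (m / suc p) * suc p) x         ≡⟨ σ^-+ (m % suc p) ((m / suc p) * suc p) x ⟩
    σ^ (m % suc p) (σ^ ((m / suc p) * suc p) x)    ≡⟨ cong (σ^ (m % suc p)) (σ^-*-fixed (suc p) x e (m / suc p)) ⟩
    σ^ (m % suc p) x                               ∎
    where open ≡-Reasoning

  period : ∀ x → ∃ λ d → 1 ≤ d × d < 1 + n × σ^ d x ≡ x
  period x with FinP.pigeonhole (n<1+n n) (λ (i : Fin (suc n)) → σ^ (toℕ i) x)
  ... | i , j , i<j , e =
    d , m<n⇒0<n∸m i<j , s≤s (≤-trans (m∸n≤m (toℕ j) (toℕ i)) (FinP.toℕ≤pred[n] j)) , sym (σ^-injective (toℕ i) shifted)
    where
    d : ℕ
    d = toℕ j ∸ toℕ i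
    shifted : σ^ (toℕ i) x ≡ σ^ (toℕ i) (σ^ d x)
    shifted = begin
      σ^ (toℕ i) x             ≡⟨ e ⟩
      σ^ (toℕ j) x             ≡⟨ cong (λ z → σ^ z x) (trans (sym (m∸n+n≡m (<⇒≤ i<j))) (+-comm d (toℕ i))) ⟩
      σ^ (toℕ i + d) x         ≡⟨ σ^-+ (toℕ i) d x ⟩
      σ^ (toℕ i) (σ^ d x)      ∎
      where open ≡-Reasoning

  len : Fin n → ℕ
  len = orbitLen σ

  len-least : ∀ x → LeastFrom (λ m → eqFin (σ^ m x) x) 1 (len x)
  len-least x with period x
  ... | d , 1≤d , d≤n , σ^d≡ =
    subst (LeastFrom P 1) (cong (λ l → part (filterᵇ P l) 0) (sym (map-suc-upTo n)))
      (head-filterᵇ-range P 1 n d 1≤d d≤n (≡⇒eqFin≡true σ^d≡))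
    where
    P : ℕ → Bool
    P m = eqFin (σ^ m x) x

  σ^-len : ∀ x → σ^ (len x) x ≡ x
  σ^-len x = eqFin≡true⇒≡ (LeastFrom.hit (len-least x))

  σ^-<len : ∀ x m → 1 ≤ m → m < len x → ¬ σ^ m x ≡ x
  σ^-<len x m 1≤m m<len e = false≢true (trans (sym (LeastFrom.least (len-least x) m 1≤m m<len)) (≡⇒eqFin≡true e))

  len-suc : ∀ x → ∃ λ p → len x ≡ suc p
  len-suc x with len x | LeastFrom.lower (len-least x)
  ... | suc p | _ = p , refl

  _∈ₒ_ : Fin n → Fin n → Set
  x ∈ₒ y = ∃ λ j → j < len y × σ^ j y ≡ x

  σ^-∈ₒ : ∀ m y x → σ^ m y ≡ x → x ∈ₒ y
  σ^-∈ₒ m y x e with len-suc y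
  ... | p , len≡ = m % suc p , subst (m % suc p <_) (sym len≡) (m%n<n m (suc p)) ,
                   trans (sym (σ^-% p y (subst (λ l → σ^ l y ≡ y) len≡ (σ^-len y)) m)) e

  ∈ₒ-refl : ∀ y → y ∈ₒ y
  ∈ₒ-refl y = 0 , LeastFrom.lower (len-least y) , refl

  ∈ₒ-next : ∀ {x y} → x ∈ₒ y → next x ∈ₒ y
  ∈ₒ-next {x} {y} (j , _ , e) = σ^-∈ₒ (suc j) y (next x) (cong next e)

  ∈ₒ-trans : ∀ {x y z} → x ∈ₒ y → y ∈ₒ z → x ∈ₒ z
  ∈ₒ-trans {x} {y} {z} (j , _ , e) (j′ , _ , e′) =
    σ^-∈ₒ (j + j′) z x (trans (σ^-+ j j′ z) (trans (cong (σ^ j) e′) e))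

  ∈ₒ-sym : ∀ {x y} → x ∈ₒ y → y ∈ₒ x
  ∈ₒ-sym {x} {y} (j , j<len , e) = σ^-∈ₒ (len y ∸ j) x y (begin
    σ^ (len y ∸ j) x             ≡⟨ cong (σ^ (len y ∸ j)) (sym e) ⟩
    σ^ (len y ∸ j) (σ^ j y)      ≡⟨ sym (σ^-+ (len y ∸ j) j y) ⟩
    σ^ (len y ∸ j + j) y         ≡⟨ cong (λ z → σ^ z y) (m∸n+n≡m (<⇒≤ j<len)) ⟩
    σ^ (len y) y                 ≡⟨ σ^-len y ⟩
    y                            ∎)
    where open ≡-Reasoning

  σ^-no-return : ∀ y i i′ → i < i′ → i′ < len y → ¬ σ^ i y ≡ σ^ i′ y
  σ^-no-return y i i′ i<i′ i′<len e =
    σ^-<len y (i′ ∸ i) (m<n⇒0<n∸m i<i′) (≤-<-trans (m∸n≤m i′ i) i′<len) (sym (σ^-injective i (begin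
      σ^ i y                   ≡⟨ e ⟩
      σ^ i′ y                  ≡⟨ cong (λ z → σ^ z y) (sym (trans (+-comm i (i′ ∸ i)) (m∸n+n≡m (<⇒≤ i<i′)))) ⟩
      σ^ (i + (i′ ∸ i)) y      ≡⟨ σ^-+ i (i′ ∸ i) y ⟩
      σ^ i (σ^ (i′ ∸ i) y)     ∎)))
    where open ≡-Reasoning

  σ^-distinct : ∀ y j j′ → j < len y → j′ < len y → σ^ j y ≡ σ^ j′ y → j ≡ j′
  σ^-distinct y j j′ j<len j′<len e with <-cmp j j′
  ... | tri≈ _ j≡j′ _ = j≡j′
  ... | tri< j<j′ _ _ = ⊥-elim (σ^-no-return y j j′ j<j′ j′<len e)
  ... | tri> _ _ j′<j = ⊥-elim (σ^-no-return y j′ j j′<j j<len (sym e))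

  cycleMin⁻ : ∀ y → cycleMin σ y ≡ true → ∀ m → toℕ y ≤ toℕ (σ^ m y)
  cycleMin⁻ y e m with σ^-∈ₒ m y (σ^ m y) refl
  ... | j , j<len , σ^j≡ = subst (λ z → toℕ y ≤ toℕ z) σ^j≡
    (≤ᵇ≡true⇒≤ (all-true⁻ (λ j → toℕ y ≤ᵇ toℕ (σ^ j y)) (upTo (len y)) e j (∈-upTo⁺ j<len)))

  cycleMin⁺ : ∀ y → (∀ j → j < len y → toℕ y ≤ toℕ (σ^ j y)) → cycleMin σ y ≡ true
  cycleMin⁺ y h = all-true⁺ (λ j → toℕ y ≤ᵇ toℕ (σ^ j y)) (upTo (len y)) (λ j j∈ → ≤⇒≤ᵇ≡true (h j (∈-upTo⁻ j∈)))

  cycleMin-unique : ∀ {y y′} → cycleMin σ y ≡ true → cycleMin σ y′ ≡ true → y′ ∈ₒ y → y ≡ y′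
  cycleMin-unique {y} {y′} min min′ y′∈y@(j , _ , e) with ∈ₒ-sym y′∈y
  ... | j′ , _ , e′ = FinP.toℕ-injective (≤-antisym (subst (λ z → toℕ y ≤ toℕ z) e (cycleMin⁻ y min j))
                                                    (subst (λ z → toℕ y′ ≤ toℕ z) e′ (cycleMin⁻ y′ min′ j′)))

  minExponent : Fin n → ℕ
  minExponent x = argmin (λ j → toℕ (σ^ j x)) (len x)

  minExponent-spec : ∀ x → minExponent x < len x × (∀ j → j < len x → toℕ (σ^ (minExponent x) x) ≤ toℕ (σ^ j x))
  minExponent-spec x with len x | len-suc x
  ... | .(suc p) | p , refl = argmin-spec (λ j → toℕ (σ^ j x)) p

  rep : Fin n → Fin n
  rep x = σ^ (minExponent x) x

  rep-cycleMin : ∀ x → cycleMin σ (rep x) ≡ true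
  rep-cycleMin x = cycleMin⁺ (rep x) (λ j _ →
    subst (λ z → toℕ (rep x) ≤ toℕ z) (σ^-+ j (minExponent x) x) (rep-≤ (j + minExponent x)))
    where
    rep-≤ : ∀ m → toℕ (rep x) ≤ toℕ (σ^ m x)
    rep-≤ m with σ^-∈ₒ m x (σ^ m x) refl
    ... | j , j<len , e = subst (λ z → toℕ (rep x) ≤ toℕ z) e (proj₂ (minExponent-spec x) j j<len)

  rep-∈ₒ : ∀ x → rep x ∈ₒ x
  rep-∈ₒ x = minExponent x , proj₁ (minExponent-spec x) , refl

  ∈ₒ-rep : ∀ x → x ∈ₒ rep x
  ∈ₒ-rep x = ∈ₒ-sym (rep-∈ₒ x)

  rep-unique : ∀ x y → cycleMin σ y ≡ true → x ∈ₒ y → rep x ≡ y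
  rep-unique x y min x∈y = sym (cycleMin-unique min (rep-cycleMin x) (∈ₒ-trans (rep-∈ₒ x) x∈y))

  reps : List (Fin n)
  reps = filterᵇ (cycleMin σ) (allFin n)

  c : ℕ
  c = length reps

  ρ : Fin c → Fin n
  ρ = Data.List.lookup reps

  reps-unique : Unique reps
  reps-unique = filterᵇ-unique (cycleMin σ) (Unique.allFin⁺ n)

  reps-cycleMin : ∀ {y} → y ∈ reps → cycleMin σ y ≡ true
  reps-cycleMin y∈ = proj₂ (∈-filterᵇ⁻ (cycleMin σ) {xs = allFin n} y∈)

  rep∈reps : ∀ x → rep x ∈ reps
  rep∈reps x = ∈-filterᵇ⁺ (cycleMin σ) (∈-allFin (rep x)) (rep-cycleMin x)

  cycleIndex : Fin n → Fin c
  cycleIndex x = Any.index (rep∈reps x)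

  ρ-cycleIndex : ∀ x → ρ (cycleIndex x) ≡ rep x
  ρ-cycleIndex x = sym (lookup-index (rep∈reps x))

  cycleIndex-next : ∀ x → cycleIndex (next x) ≡ cycleIndex x
  cycleIndex-next x = lookup-injective reps reps-unique _ _ (begin
    ρ (cycleIndex (next x))  ≡⟨ ρ-cycleIndex (next x) ⟩
    rep (next x)             ≡⟨ rep-unique (next x) (rep x) (rep-cycleMin x) (∈ₒ-next (∈ₒ-rep x)) ⟩
    rep x                    ≡⟨ sym (ρ-cycleIndex x) ⟩
    ρ (cycleIndex x)         ∎)
    where open ≡-Reasoning

  cycleIndex-ρ : ∀ j → cycleIndex (ρ j) ≡ j
  cycleIndex-ρ j = lookup-injective reps reps-unique _ _
    (trans (ρ-cycleIndex (ρ j)) (rep-unique (ρ j) (ρ j) (reps-cycleMin (∈-lookup j)) (∈ₒ-refl (ρ j))))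

  cycle : Fin n → List (Fin n)
  cycle y = map (λ m → σ^ m y) (upTo (len y))

  cycles : List (Fin n)
  cycles = concatMap cycle reps

  cycles-unique : Unique cycles
  cycles-unique = concatMap-unique cycle reps reps-unique
    (λ y _ → map-unique-on (λ m → σ^ m y) (upTo (len y)) (Unique.upTo⁺ (len y))
               (λ a b a∈ b∈ → σ^-distinct y a b (∈-upTo⁻ a∈) (∈-upTo⁻ b∈)))
    (λ y y′ v y∈ y′∈ v∈ v∈′ → cycleMin-unique (reps-cycleMin y∈) (reps-cycleMin y′∈)
                                 (∈ₒ-trans (∈ₒ-sym (on-cycle v∈′)) (on-cycle v∈)))
    where
    on-cycle : ∀ {y v} → v ∈ cycle y → v ∈ₒ y
    on-cycle {y} v∈ with ∈-map⁻ (λ m → σ^ m y) v∈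
    ... | j , j∈ , e = j , ∈-upTo⁻ j∈ , sym e

  ∈-cycles : ∀ x → x ∈ cycles
  ∈-cycles x with ∈ₒ-rep x
  ... | j , j<len , e = ∈-concatMap⁺′ cycle (rep∈reps x) (subst (_∈ cycle (rep x)) e (∈-map⁺ (λ m → σ^ m (rep x)) (∈-upTo⁺ j<len)))

  count-invariant : ∀ (P : Fin n → Bool) → (∀ x → P (next x) ≡ P x) →
    count P (allFin n) ≡ sumBy (λ j → when (P (ρ j)) (len (ρ j))) (allFin c)
  count-invariant P invariant = begin
    count P (allFin n)
      ≡⟨ count-≡ P P (λ x → x) (λ x → x) (allFin n) cycles (Unique.allFin⁺ n) cycles-unique
                 (λ a _ e → (∈-cycles a , e) , refl) (λ b _ e → (∈-allFin b , e) , refl) ⟩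
    count P cycles
      ≡⟨ count-concatMap P cycle reps ⟩
    sumBy (λ y → count P (cycle y)) reps
      ≡⟨ sumBy-cong _ _ reps (λ y _ → per-cycle y) ⟩
    sumBy (λ y → when (P y) (len y)) reps
      ≡⟨ sumBy-lookup (λ y → when (P y) (len y)) reps ⟩
    sumBy (λ j → when (P (ρ j)) (len (ρ j))) (allFin c) ∎
    where
    open ≡-Reasoning
    P-σ^ : ∀ m y → P (σ^ m y) ≡ P y
    P-σ^ zero    y = refl
    P-σ^ (suc m) y = trans (invariant (σ^ m y)) (P-σ^ m y)
    per-cycle : ∀ y → count P (cycle y) ≡ when (P y) (len y)
    per-cycle y = begin
      count P (cycle y)                        ≡⟨ count-map P (λ m → σ^ m y) (upTo (len y)) ⟩
      count (λ m → P (σ^ m y)) (upTo (len y))  ≡⟨ count-cong _ _ (upTo (len y)) (λ m _ → P-σ^ m y) ⟩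
      count (λ _ → P y) (upTo (len y))         ≡⟨ count-const (P y) (upTo (len y)) ⟩
      when (P y) (length (upTo (len y)))       ≡⟨ cong (when (P y)) (LP.length-upTo (len y)) ⟩
      when (P y) (len y)                       ∎

toList≡tabulate-lookup : ∀ {A : Set} {m} (v : Vec A m) → Vec.toList v ≡ Data.List.tabulate (Vec.lookup v)
toList≡tabulate-lookup []      = refl
toList≡tabulate-lookup (x ∷ v) = cong (x ∷_) (toList≡tabulate-lookup v)

part-fromList : ∀ (l : List ℕ) (i : Fin (length l)) → part l (toℕ i) ≡ Vec.lookup (Vec.fromList l) i
part-fromList (a ∷ l) Fin.zero    = refl
part-fromList (a ∷ l) (Fin.suc i) = part-fromList l i

-- A tabloid fixed by σ is constant on each cycle of σ.
module FixedTabloids {n : ℕ} (σ : Permutation′ n) (λ′ : List ℕ) where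
  open Cycles σ

  r : ℕ
  r = length λ′

  capacities : Vec ℕ r
  capacities = Vec.fromList λ′

  cycleLens : Fin c → ℕ
  cycleLens j = len (ρ j)

  isFixedTabloid : Vec (Fin r) n → Bool
  isFixedTabloid f = isTabloid λ′ f ∧ fixedBy σ f

  restrict : Vec (Fin r) n → Vec (Fin r) c
  restrict f = Vec.tabulate (λ j → Vec.lookup f (ρ j))

  extend : Vec (Fin r) c → Vec (Fin r) n
  extend a = Vec.tabulate (λ x → Vec.lookup a (cycleIndex x))

  RowSizes : Vec (Fin r) n → Set
  RowSizes f = ∀ i → count (λ x → eqFin i (Vec.lookup f x)) (allFin n) ≡ Vec.lookup capacities i

  Invariant : Vec (Fin r) n → Set
  Invariant f = ∀ x → Vec.lookup f (next x) ≡ Vec.lookup f x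

  countFin-toList : ∀ (f : Vec (Fin r) n) i →
    countFin i (Vec.toList f) ≡ count (λ x → eqFin i (Vec.lookup f x)) (allFin n)
  countFin-toList f i = begin
    countFin i (Vec.toList f)                          ≡⟨ length-filterᵇ (eqFin i) (Vec.toList f) ⟩
    count (eqFin i) (Vec.toList f)                     ≡⟨ cong (count (eqFin i)) (toList≡tabulate-lookup f) ⟩
    count (eqFin i) (Data.List.tabulate (Vec.lookup f)) ≡⟨ cong (count (eqFin i)) (sym (LP.map-tabulate (λ x → x) (Vec.lookup f))) ⟩
    count (eqFin i) (map (Vec.lookup f) (allFin n))    ≡⟨ count-map (eqFin i) (Vec.lookup f) (allFin n) ⟩
    count (λ x → eqFin i (Vec.lookup f x)) (allFin n)  ∎
    where open ≡-Reasoning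

  isTabloid⁻ : ∀ f → isTabloid λ′ f ≡ true → RowSizes f
  isTabloid⁻ f e i = trans (sym (countFin-toList f i)) (trans (≡ᵇ≡true⇒≡ (allFin-true⁻ _ e i)) (part-fromList λ′ i))

  isTabloid⁺ : ∀ f → RowSizes f → isTabloid λ′ f ≡ true
  isTabloid⁺ f h = allFin-true⁺ _ (λ i → ≡⇒≡ᵇ≡true (trans (countFin-toList f i) (trans (h i) (sym (part-fromList λ′ i)))))

  fixedBy⁻ : ∀ f → fixedBy σ f ≡ true → Invariant f
  fixedBy⁻ f e x = eqFin≡true⇒≡ (allFin-true⁻ (λ y → eqFin (Vec.lookup f (σ ⟨$⟩ʳ y)) (Vec.lookup f y)) e x)

  fixedBy⁺ : ∀ f → Invariant f → fixedBy σ f ≡ true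
  fixedBy⁺ f h = allFin-true⁺ (λ y → eqFin (Vec.lookup f (σ ⟨$⟩ʳ y)) (Vec.lookup f y)) (λ x → ≡⇒eqFin≡true (h x))

  row-size≡load : ∀ (h : Fin n → Fin r) → (∀ x → h (next x) ≡ h x) → ∀ i →
    count (λ x → eqFin i (h x)) (allFin n) ≡ load c cycleLens (Vec.tabulate (λ j → h (ρ j))) i
  row-size≡load h invariant i = begin
    count (λ x → eqFin i (h x)) (allFin n)                          ≡⟨ count-cong _ _ (allFin n) (λ x _ → eqFin-sym i (h x)) ⟩
    count (λ x → eqFin (h x) i) (allFin n)                          ≡⟨ count-invariant (λ x → eqFin (h x) i)
                                                                                       (λ x → cong (λ z → eqFin z i) (invariant x)) ⟩
    sumBy (λ j → when (eqFin (h (ρ j)) i) (cycleLens j)) (allFin c) ≡⟨ sym (load-tabulate c cycleLens (λ j → h (ρ j)) i) ⟩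
    load c cycleLens (Vec.tabulate (λ j → h (ρ j))) i               ∎
    where open ≡-Reasoning

  restrict-embeds : Embeds isFixedTabloid (allVecs r n) (fills c cycleLens capacities) (allVecs r c) restrict extend
  restrict-embeds f _ e =
    (allVecs-complete r c (restrict f) ,
     allFin-true⁺ _ (λ i → ≡⇒≡ᵇ≡true (trans (sym (row-size≡load (Vec.lookup f) invariant i)) (isTabloid⁻ f (∧-trueˡ e) i)))) ,
    trans (VP.tabulate-cong (λ x → trans (VP.lookup∘tabulate _ (cycleIndex x)) (trans (cong (Vec.lookup f) (ρ-cycleIndex x)) (f-rep x))))
          (VP.tabulate∘lookup f)
    where
    invariant : Invariant f
    invariant = fixedBy⁻ f (∧-trueʳ {isTabloid λ′ f} e)
    f-σ^ : ∀ m x → Vec.lookup f (σ^ m x) ≡ Vec.lookup f x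
    f-σ^ zero    x = refl
    f-σ^ (suc m) x = trans (invariant (σ^ m x)) (f-σ^ m x)
    f-rep : ∀ x → Vec.lookup f (rep x) ≡ Vec.lookup f x
    f-rep x = let m , _ , e = ∈ₒ-rep x in trans (sym (f-σ^ m (rep x))) (cong (Vec.lookup f) e)

  extend-embeds : Embeds (fills c cycleLens capacities) (allVecs r c) isFixedTabloid (allVecs r n) extend restrict
  extend-embeds a _ e =
    (allVecs-complete r n (extend a) , ∧-true (isTabloid⁺ (extend a) row-sizes) (fixedBy⁺ (extend a) invariant)) ,
    trans (VP.tabulate-cong (λ j → trans (VP.lookup∘tabulate _ (ρ j)) (cong (Vec.lookup a) (cycleIndex-ρ j)))) (VP.tabulate∘lookup a)
    where
    h : Fin n → Fin r
    h x = Vec.lookup a (cycleIndex x)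
    lookup-extend : ∀ x → Vec.lookup (extend a) x ≡ h x
    lookup-extend = VP.lookup∘tabulate h
    invariant : Invariant (extend a)
    invariant x = trans (lookup-extend (next x)) (trans (cong (Vec.lookup a) (cycleIndex-next x)) (sym (lookup-extend x)))
    row-sizes : RowSizes (extend a)
    row-sizes i = begin
      count (λ x → eqFin i (Vec.lookup (extend a) x)) (allFin n)  ≡⟨ count-cong _ _ (allFin n) (λ x _ → cong (eqFin i) (lookup-extend x)) ⟩
      count (λ x → eqFin i (h x)) (allFin n)                      ≡⟨ row-size≡load h (λ x → cong (Vec.lookup a) (cycleIndex-next x)) i ⟩
      load c cycleLens (Vec.tabulate (λ j → h (ρ j))) i           ≡⟨ cong (λ v → load c cycleLens v i) restrict-extend ⟩
      load c cycleLens a i                                        ≡⟨ ≡ᵇ≡true⇒≡ (allFin-true⁻ _ e i) ⟩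
      Vec.lookup capacities i                                     ∎
      where
      open ≡-Reasoning
      restrict-extend : Vec.tabulate (λ j → h (ρ j)) ≡ a
      restrict-extend = trans (VP.tabulate-cong (λ j → cong (Vec.lookup a) (cycleIndex-ρ j))) (VP.tabulate∘lookup a)

  ξ≡fillings : ξ n λ′ σ ≡ fillings (cycleType σ) capacities
  ξ≡fillings = begin
    ξ n λ′ σ                                                  ≡⟨ length-filterᵇ isFixedTabloid (allVecs r n) ⟩
    count isFixedTabloid (allVecs r n)                        ≡⟨ count-≡ _ _ restrict extend _ _ (allVecs-unique r n) (allVecs-unique r c)
                                                                   restrict-embeds extend-embeds ⟩
    count (fills c cycleLens capacities) (allVecs r c)        ≡⟨ count-fills≡fillings c cycleLens capacities ⟩
    fillings (Data.List.tabulate cycleLens) capacities        ≡⟨ cong (λ l → fillings l capacities) cycleLens≡ ⟩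
    fillings (map len reps) capacities                        ≡⟨ fillings-↭ (↭.↭-sym (sortDesc-↭ (map len reps))) capacities ⟩
    fillings (cycleType σ) capacities                         ∎
    where
    open ≡-Reasoning
    cycleLens≡ : Data.List.tabulate cycleLens ≡ map len reps
    cycleLens≡ = trans (sym (LP.map-tabulate ρ len)) (cong (map len) (LP.tabulate-lookup reps))

lookup-fromList≤sum : ∀ (l : List ℕ) (y : Fin (length l)) → Vec.lookup (Vec.fromList l) y ≤ sum l
lookup-fromList≤sum (a ∷ l) Fin.zero    = m≤m+n a (sum l)
lookup-fromList≤sum (a ∷ l) (Fin.suc y) = ≤-trans (lookup-fromList≤sum l y) (m≤n+m (sum l) a)

ξ-withHead : ∀ {k N Λ M} → 2 * k < N → SmallPartition k Λ → SmallPartition k M →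
  (σ : Permutation′ N) → cycleType σ ≡ withHead N M →
  ξ N (withHead N Λ) σ ≡ when (sum Λ ≤ᵇ sum M) (fillings M ((sum M ∸ sum Λ) ∷ Vec.fromList Λ))
ξ-withHead {k} {N} {Λ} {M} 2k<N Λ-small M-small σ type≡ = begin
  ξ N (withHead N Λ) σ                                              ≡⟨ FixedTabloids.ξ≡fillings σ (withHead N Λ) ⟩
  fillings (cycleType σ) (Vec.fromList (withHead N Λ))              ≡⟨ cong (λ l → fillings l (Vec.fromList (withHead N Λ))) type≡ ⟩
  fillings (withHead N M) ((N ∸ sum Λ) ∷ Vec.fromList Λ)            ≡⟨ fillings-large-head N (sum Λ) (sum M) M (Vec.fromList Λ) 2k<N Λ≤k M≤k
                                                                         (λ y → ≤-trans (lookup-fromList≤sum Λ y) Λ≤k) ⟩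
  when (sum Λ ≤ᵇ sum M) (fillings M ((sum M ∸ sum Λ) ∷ Vec.fromList Λ)) ∎
  where
  open ≡-Reasoning
  open SmallPartition Λ-small renaming (small to Λ≤k)
  open SmallPartition M-small renaming (small to M≤k)

ξ-star : ∀ {k n n′} → 2 * k < n → 2 * k < n′ → (λ′ μ : List ℕ) → 𝓕 n k λ′ → 𝓕 n k μ →
  (σ : Permutation′ n) (τ : Permutation′ n′) → cycleType σ ≡ μ → cycleType τ ≡ star n n′ μ →
  ξ n λ′ σ ≡ ξ n′ (star n n′ λ′) τ
ξ-star {k} {n} {n′} 2k<n 2k<n′ λ′ μ λ′∈𝓕 μ∈𝓕 σ τ σ-type τ-type
  with 𝓕-withHead λ′ (k<n {k} 2k<n) λ′∈𝓕 | 𝓕-withHead μ (k<n {k} 2k<n) μ∈𝓕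
... | Λ , Λ-small , refl | M , M-small , refl = begin
  ξ n (withHead n Λ) σ                    ≡⟨ ξ-withHead {k} 2k<n Λ-small M-small σ σ-type ⟩
  when (sum Λ ≤ᵇ sum M) _                 ≡⟨ sym (ξ-withHead {k} 2k<n′ Λ-small M-small τ τ-type′) ⟩
  ξ n′ (withHead n′ Λ) τ                  ≡⟨ cong (λ l → ξ n′ l τ) (sym (star-withHead-small {k} 2k<n 2k<n′ Λ-small)) ⟩
  ξ n′ (star n n′ (withHead n Λ)) τ       ∎
  where
  open ≡-Reasoning
  τ-type′ : cycleType τ ≡ withHead n′ M
  τ-type′ = trans τ-type (star-withHead-small {k} 2k<n 2k<n′ M-small)

proposition1 : (k n n′ : ℕ) → 2 * k < n → 2 * k < n′ →
      ((λ′ : List ℕ) → 𝓕 n k λ′ → 𝓕 n′ k (star n n′ λ′))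
    × ((λ′ ν : List ℕ) → 𝓕 n k λ′ → 𝓕 n k ν → star n n′ λ′ ≡ star n n′ ν → λ′ ≡ ν)
    × ((ν : List ℕ) → 𝓕 n′ k ν → Σ (List ℕ) (λ λ′ → 𝓕 n k λ′ × star n n′ λ′ ≡ ν))
    × ((λ′ μ : List ℕ) → 𝓕 n k λ′ → 𝓕 n k μ →
         kostka n λ′ μ ≡ kostka n′ (star n n′ λ′) (star n n′ μ))
    × ((λ′ μ : List ℕ) → 𝓕 n k λ′ → 𝓕 n k μ →
         (σ : Permutation′ n) (τ : Permutation′ n′) →
         cycleType σ ≡ μ → cycleType τ ≡ star n n′ μ →
         ξ n λ′ σ ≡ ξ n′ (star n n′ λ′) τ)
proposition1 k n n′ 2k<n 2k<n′ =
    star-𝓕 {k} 2k<n 2k<n′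
  , star-injective {k} 2k<n 2k<n′
  , star-surjective {k} 2k<n 2k<n′
  , kostka-star {k} 2k<n 2k<n′
  , ξ-star {k} 2k<n 2k<n′
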